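{- Let $\phi(X)$ be an MSO$_1$ formula with one free vertex-set variable, $G=(V,E,\mathcal{C})$ a colored graph, and $S,S'\subseteq V$ with $G\models\phi(S)$, $G\models\phi(S')$, $|S|=|S'|=k$, where $S$ and $S'$ are among the colors of $\mathcal{C}$. Let $\bar\sigma$ and $\bar\sigma'$ be the shapes of $S$ and $S'$, respectively. There is a $\mathsf{TJ}(\phi)$-sequence from $S$ to $S'$ if and only if $\bar\sigma$ and $\bar\sigma'$ belong to the same connected component of the size-$k$ shape graph $\mathcal{S}_k$.
   Context: A colored graph is $G=(V,E,\mathcal{C})$ with $\mathcal{C}=\langle C_1,\dots,C_c\rangle$ a tuple of subsets of $V$ (colors); $\mathcal{C}(v)$ is the set of colors containing $v$. MSO$_1$ formulas use vertex and vertex-set variables, atomic formulas $x=y$, $E(x,y)$, $C_i(x)$, $X(x)$, Boolean connectives and quantification. A set $X\subseteq V$ is feasible if $G\models\phi(X)$. A $\mathsf{TJ}(\phi)$-sequence from $S_0$ to $S_\ell$ is a sequence $S_0,\dots,S_\ell$ of vertex subsets with $|S_{i-1}\setminus S_i|=|S_i\setminus S_{i-1}|=1$ for $i\in[\ell]$ and $G\models\phi(S_i)$ for all $i$. Write $q=\mathsf{q}(\phi)=2^{q_s}\cdot q_v$ where $q_s$, $q_v$ are the numbers of set and vertex quantifiers in $\phi$. Two vertices $u,v$ have the same type if they are twins ($N(u)=N(v)$ or $N[u]=N[v]$) and $\mathcal{C}(u)=\mathcal{C}(v)$; let $V_1,\dots,V_t$ be the type partition of $V$. The signature of $X$ is $\sigma_X(i)=|V_i\cap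 X|$. A shape is a map $\bar\sigma$ on $[t]$ with $\bar\sigma(i)\in[0,q-1]\cup\{\bot\}\cup[|V_i|-q+1,|V_i|]$; $X$ has shape $\bar\sigma$ if for every $i$, $\bar\sigma(i)=\bot$ when $q\le\sigma_X(i)\le|V_i|-q$ and $\bar\sigma(i)=\sigma_X(i)$ otherwise. A shape is $k$-feasible if some feasible set of size $k$ has it. Conditions for an index $i$ relative to $(\bar\sigma_1,\bar\sigma_2)$: A1: $\bar\sigma_1(i),\bar\sigma_2(i)\ne\bot$ and $\bar\sigma_2(i)=\bar\sigma_1(i)-1$; A2: $\bar\sigma_1(i)=\bot$ and $\bar\sigma_2(i)=q-1$; A3: $\bar\sigma_1(i)=|V_i|-q+1$ and $\bar\sigma_2(i)=\bot$. For an index $j$: B1: $\bar\sigma_1(j),\bar\sigma_2(j)\ne\bot$ and $\bar\sigma_1(j)=\bar\sigma_2(j)-1$; B2: $\bar\sigma_2(j)=\bot$ and $\bar\sigma_1(j)=q-1$; B3: $\bar\sigma_2(j)=|V_j|-q+1$ and $\bar\sigma_1(j)=\bot$. Two $k$-feasible shapes $\bar\sigma_1,\bar\sigma_2$ are adjacent iff (1) either they disagree at exactly two indices $i,j$ with $i$ satisfying one of A1–A3 and $j$ one of B1–B3, or they disagree at exactly one index, which is an index $i$ satisfying one of A1–A3 or an index $j$ satisfying one of B1–B3; (2) some size-$k$ set $S_1$ of shape $\bar\sigma_1$ has $\sigma_{S_1}(i)=q$ whenever $i$ is defined and $\bar\sigma_1(i)=\bot$, and $\sigma_{S_1}(j)=|V_j|-q$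 whenever $j$ is defined and $\bar\sigma_1(j)=\bot$; (3) some size-$k$ set $S_2$ of shape $\bar\sigma_2$ has $\sigma_{S_2}(i)=|V_i|-q$ whenever $i$ is defined and $\bar\sigma_2(i)=\bot$, and $\sigma_{S_2}(j)=q$ whenever $j$ is defined and $\bar\sigma_2(j)=\bot$. The size-$k$ shape graph $\mathcal{S}_k$ has the $k$-feasible shapes as vertices and this adjacency as edges. -}

module Defs where

open import Data.Nat using (ℕ; zero; suc; _+_; _*_; _∸_; _^_; _≤_)
open import Data.Nat.Properties using (_≤?_)
open import Data.Bool using (Bool; true; false; _∧_; _∨_)
open import Data.Fin using (Fin; _≟_)
open import Data.Fin.Subset using (Subset; _∈_; _∩_; _─_; ∣_∣)
open import Data.Vec using (Vec; []; _∷_; lookup; tabulate)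
open import Data.Maybe using (Maybe; just; nothing)
open import Data.Product using (Σ; ∃; _×_; _,_)
open import Data.Sum using (_⊎_)
open import Data.Empty using (⊥)
open import Relation.Nullary using (¬_; Dec; yes; no)
open import Relation.Nullary.Decidable using (⌊_⌋)
open import Relation.Binary.PropositionalEquality using (_≡_; _≢_)
open import Relation.Binary.Construct.Closure.ReflexiveTransitive using (Star)
open import Relation.Binary.Construct.Closure.Symmetric using (SymClosure)
open import Function.Bundles using (_⇔_)

record ColoredGraph (n c : ℕ) : Set where
  field
    adj    : Fin n → Fin n → Bool
    sym    : ∀ u v → adj u v ≡ adj v u
    irrefl : ∀ v → adj v v ≡ false
    color  : Fin c → Subset n

-- MSO₁ formulas over c colors, with nv free vertex variables and ns free
-- vertex-set variables (de Bruijn indices).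

data Formula (c : ℕ) : ℕ → ℕ → Set where
  eq   : ∀ {nv ns} → Fin nv → Fin nv → Formula c nv ns
  edge : ∀ {nv ns} → Fin nv → Fin nv → Formula c nv ns
  col  : ∀ {nv ns} → Fin c → Fin nv → Formula c nv ns
  mem  : ∀ {nv ns} → Fin nv → Fin ns → Formula c nv ns
  ¬'   : ∀ {nv ns} → Formula c nv ns → Formula c nv ns
  _∧'_ : ∀ {nv ns} → Formula c nv ns → Formula c nv ns → Formula c nv ns
  _∨'_ : ∀ {nv ns} → Formula c nv ns → Formula c nv ns → Formula c nv ns
  _⇒'_ : ∀ {nv ns} → Formula c nv ns → Formula c nv ns → Formula c nv ns
  ∃v   : ∀ {nv ns} → Formula c (suc nv) ns → Formula c nv ns
  ∀v   : ∀ {nv ns} → Formula c (suc nv) ns → Formula c nv ns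
  ∃s   : ∀ {nv ns} → Formula c nv (suc ns) → Formula c nv ns
  ∀s   : ∀ {nv ns} → Formula c nv (suc ns) → Formula c nv ns

module _ {n c : ℕ} (G : ColoredGraph n c) where
  open ColoredGraph G

  Sat : ∀ {nv ns} → Formula c nv ns → Vec (Fin n) nv → Vec (Subset n) ns → Set
  Sat (eq x y)   ρ η = lookup ρ x ≡ lookup ρ y
  Sat (edge x y) ρ η = adj (lookup ρ x) (lookup ρ y) ≡ true
  Sat (col i x)  ρ η = lookup ρ x ∈ color i
  Sat (mem x X)  ρ η = lookup ρ x ∈ lookup η X
  Sat (¬' φ)     ρ η = ¬ Sat φ ρ η
  Sat (φ ∧' ψ)   ρ η = Sat φ ρ η × Sat ψ ρ η
  Sat (φ ∨' ψ)   ρ η = Sat φ ρ η ⊎ Sat ψ ρ η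
  Sat (φ ⇒' ψ)   ρ η = Sat φ ρ η → Sat ψ ρ η
  Sat (∃v φ)     ρ η = Σ (Fin n) λ v → Sat φ (v ∷ ρ) η
  Sat (∀v φ)     ρ η = (v : Fin n) → Sat φ (v ∷ ρ) η
  Sat (∃s φ)     ρ η = Σ (Subset n) λ X → Sat φ ρ (X ∷ η)
  Sat (∀s φ)     ρ η = (X : Subset n) → Sat φ ρ (X ∷ η)

  _⊨_[_] : Formula c 0 1 → Subset n → Set
  _⊨_[_] φ X = Sat φ [] (X ∷ [])

qv : ∀ {c nv ns} → Formula c nv ns → ℕ
qv (eq _ _)   = 0
qv (edge _ _) = 0
qv (col _ _)  = 0
qv (mem _ _)  = 0
qv (¬' φ)     = qv φ
qv (φ ∧' ψ)   = qv φ + qv ψ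
qv (φ ∨' ψ)   = qv φ + qv ψ
qv (φ ⇒' ψ)   = qv φ + qv ψ
qv (∃v φ)     = suc (qv φ)
qv (∀v φ)     = suc (qv φ)
qv (∃s φ)     = qv φ
qv (∀s φ)     = qv φ

qs : ∀ {c nv ns} → Formula c nv ns → ℕ
qs (eq _ _)   = 0
qs (edge _ _) = 0
qs (col _ _)  = 0
qs (mem _ _)  = 0
qs (¬' φ)     = qs φ
qs (φ ∧' ψ)   = qs φ + qs ψ
qs (φ ∨' ψ)   = qs φ + qs ψ
qs (φ ⇒' ψ)   = qs φ + qs ψ
qs (∃v φ)     = qs φ
qs (∀v φ)     = qs φ
qs (∃s φ)     = suc (qs φ)
qs (∀s φ)     = suc (qs φ)

qOf : ∀ {c nv ns} → Formula c nv ns → ℕ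
qOf φ = 2 ^ qs φ * qv φ

-- TJ(φ)-sequences: S₀,…,S_ℓ with |S_{i-1} ∖ S_i| = |S_i ∖ S_{i-1}| = 1
-- and every Sᵢ feasible.  Given S₀ feasible, such a sequence from S to S'
-- is a path in the following step relation.

module _ {n c : ℕ} (G : ColoredGraph n c) (φ : Formula c 0 1) where

  TJStep : Subset n → Subset n → Set
  TJStep A B = (G ⊨ φ [ A ]) × (G ⊨ φ [ B ]) × ∣ A ─ B ∣ ≡ 1 × ∣ B ─ A ∣ ≡ 1

  TJSequence : Subset n → Subset n → Set
  TJSequence S S' = (G ⊨ φ [ S ]) × Star TJStep S S'

module _ {n c : ℕ} (G : ColoredGraph n c) where
  open ColoredGraph G

  cadj : Fin n → Fin n → Bool
  cadj u w = ⌊ u ≟ w ⌋ ∨ adj u w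

  Twins : Fin n → Fin n → Set
  Twins u v = (∀ w → adj u w ≡ adj v w) ⊎ (∀ w → cadj u w ≡ cadj v w)

  SameType : Fin n → Fin n → Set
  SameType u v = Twins u v × (∀ i → (u ∈ color i) ⇔ (v ∈ color i))

  record TypePartition : Set where
    field
      t       : ℕ
      ty      : Fin n → Fin t
      onto    : ∀ i → ∃ λ v → ty v ≡ i
      correct : ∀ u v → (ty u ≡ ty v) ⇔ SameType u v

module _ {n c : ℕ} (G : ColoredGraph n c) (φ : Formula c 0 1)
         (P : TypePartition G) where
  open TypePartition P

  q : ℕ
  q = qOf φ

  block : Fin t → Subset n
  block i = tabulate λ v → ⌊ ty v ≟ i ⌋

  size : Fin t → ℕ
  size i = ∣ block i ∣

  sig : Subset n → Fin t → ℕ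
  sig X i = ∣ block i ∩ X ∣

  -- a shape: nothing stands for ⊥
  Shape : Set
  Shape = Vec (Maybe ℕ) t

  shapeEntry : ℕ → ℕ → Maybe ℕ
  shapeEntry s m with q ≤? s | s ≤? m ∸ q
  ... | yes _ | yes _ = nothing
  ... | _     | _     = just s

  shapeOf : Subset n → Shape
  shapeOf X = tabulate λ i → shapeEntry (sig X i) (size i)

  Feasible : ℕ → Shape → Set
  Feasible k σ̄ = Σ (Subset n) λ S → (G ⊨ φ [ S ]) × ∣ S ∣ ≡ k × shapeOf S ≡ σ̄

  CondA : Shape → Shape → Fin t → Set
  CondA σ₁ σ₂ i =
      (Σ ℕ λ a → Σ ℕ λ b → lookup σ₁ i ≡ just a × lookup σ₂ i ≡ just b × b + 1 ≡ a)
    ⊎ (lookup σ₁ i ≡ nothing × Σ ℕ λ b → lookup σ₂ i ≡ just b × b + 1 ≡ q)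
    ⊎ (Σ ℕ λ a → lookup σ₁ i ≡ just a × a + q ≡ size i + 1 × lookup σ₂ i ≡ nothing)

  CondB : Shape → Shape → Fin t → Set
  CondB σ₁ σ₂ j =
      (Σ ℕ λ a → Σ ℕ λ b → lookup σ₁ j ≡ just a × lookup σ₂ j ≡ just b × a + 1 ≡ b)
    ⊎ (lookup σ₂ j ≡ nothing × Σ ℕ λ a → lookup σ₁ j ≡ just a × a + 1 ≡ q)
    ⊎ (Σ ℕ λ b → lookup σ₂ j ≡ just b × b + q ≡ size j + 1 × lookup σ₁ j ≡ nothing)

  Cond2 : ℕ → Maybe (Fin t) → Maybe (Fin t) → Shape → Set
  Cond2 k mi mj σ₁ = Σ (Subset n) λ S₁ → ∣ S₁ ∣ ≡ k × shapeOf S₁ ≡ σ₁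
    × (∀ i → mi ≡ just i → lookup σ₁ i ≡ nothing → sig S₁ i ≡ q)
    × (∀ j → mj ≡ just j → lookup σ₁ j ≡ nothing → sig S₁ j ≡ size j ∸ q)

  Cond3 : ℕ → Maybe (Fin t) → Maybe (Fin t) → Shape → Set
  Cond3 k mi mj σ₂ = Σ (Subset n) λ S₂ → ∣ S₂ ∣ ≡ k × shapeOf S₂ ≡ σ₂
    × (∀ i → mi ≡ just i → lookup σ₂ i ≡ nothing → sig S₂ i ≡ size i ∸ q)
    × (∀ j → mj ≡ just j → lookup σ₂ j ≡ nothing → sig S₂ j ≡ q)

  AgreeOutside : Shape → Shape → Maybe (Fin t) → Maybe (Fin t) → Set
  AgreeOutside σ₁ σ₂ mi mj =
    ∀ l → mi ≢ just l → mj ≢ just l → lookup σ₁ l ≡ lookup σ₂ l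

  Adjacent : ℕ → Shape → Shape → Set
  Adjacent k σ₁ σ₂ =
      (Σ (Fin t) λ i → Σ (Fin t) λ j → i ≢ j
         × AgreeOutside σ₁ σ₂ (just i) (just j) × CondA σ₁ σ₂ i × CondB σ₁ σ₂ j
         × Cond2 k (just i) (just j) σ₁ × Cond3 k (just i) (just j) σ₂)
    ⊎ (Σ (Fin t) λ i →
         AgreeOutside σ₁ σ₂ (just i) nothing × CondA σ₁ σ₂ i
         × Cond2 k (just i) nothing σ₁ × Cond3 k (just i) nothing σ₂)
    ⊎ (Σ (Fin t) λ j →
         AgreeOutside σ₁ σ₂ nothing (just j) × CondB σ₁ σ₂ j
         × Cond2 k nothing (just j) σ₁ × Cond3 k nothing (just j) σ₂)

  ShapeEdge : ℕ → Shape → Shape → Set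
  ShapeEdge k σ₁ σ₂ = Feasible k σ₁ × Feasible k σ₂ × Adjacent k σ₁ σ₂

  SameComponent : ℕ → Shape → Shape → Set
  SameComponent k = Star (SymClosure (ShapeEdge k))

-- Feasibility depends only on the shape. Call two assignments of vertices and vertex
-- sets B-similar when they are a partial isomorphism respecting types and memberships
-- and, for every type and membership pattern, the numbers of remaining vertices agree
-- or are both at least B. This is an Ehrenfeucht–Fraïssé invariant for formulas of
-- weight 2^{q_s}·q_v at most B: a vertex quantifier costs one unit of q_v, and a set
-- quantifier halves the threshold, because each count split by the chosen set can be
-- matched on the other side. Two sets of the same shape are q(φ)-similar as set
-- assignments, hence equally feasible.
--
-- A token jump from u to v changes the signature by −1 at the type of u and +1 at the
-- type of v, which is an edge of the size-k shape graph unless the shape is unchanged;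
-- so TJ-sequences project to paths. Conversely, sets of the same shape and size are
-- joined by jumps that keep the shape (move a token within a type, or between two
-- types whose counts both lie strictly inside the ⊥ range), and every edge of the
-- shape graph is realised by one jump from a suitable set of its first shape, so paths
-- lift to TJ-sequences.

module Submission where

open import Defs
open import Data.Nat using (ℕ; zero; suc; _+_; _*_; _∸_; _^_; _≤_; _<_; z≤n; s≤s)
open import Data.Nat.Properties hiding (_≟_)
open import Data.Nat.Properties using () renaming (_≟_ to _≟ℕ_)
open import Algebra.Properties.CommutativeSemigroup +-commutativeSemigroup using (interchange)
open import Algebra.Properties.CommutativeMonoid.Sum +-0-commutativeMonoid using (sum; sum-cong-≗; ∑-distrib-+; ∑-comm; sum-replicate-zero)
open import Data.Bool using (Bool; true; false; _∧_; _∨_; not; if_then_else_)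
open import Data.Bool.Properties using (∧-zeroʳ; ∧-identityʳ)
open import Data.Empty using (⊥-elim)
open import Data.Fin using (Fin; zero; suc; _≟_)
open import Data.Fin.Properties using () renaming (suc-injective to Fin-suc-injective)
open import Data.Fin.Subset using (Subset; ∣_∣; _∩_; _─_)
open import Data.Maybe using (Maybe; just; nothing)
open import Data.Maybe.Properties using (just-injective) renaming (≡-dec to Maybe-≡-dec)
open import Data.Product using (Σ; ∃; ∃₂; _×_; _,_; proj₁; proj₂)
open import Data.Sum using (_⊎_; inj₁; inj₂)
open import Data.Vec using (Vec; []; _∷_; lookup; map; tabulate)
open import Data.Vec.Functional using () renaming (_∷_ to _◂_)
open import Data.Vec.Properties using (lookup∘tabulate; lookup-map; lookup-zipWith; []=⇒lookup; lookup⇒[]=; tabulate∘lookup; tabulate-cong)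
open import Function using (_∘_)
open import Function.Bundles using (_⇔_; mk⇔; Equivalence)
open import Relation.Binary.Construct.Closure.ReflexiveTransitive using (Star; ε; _◅_; _◅◅_)
open import Relation.Binary.Construct.Closure.Symmetric using (SymClosure; fwd; bwd)
open import Relation.Binary.PropositionalEquality hiding (J)
open import Relation.Nullary using (¬_; yes; no)
open import Relation.Nullary.Decidable using (⌊_⌋; dec-true; dec-false; isYes≗does)

private
  variable
    n k m : ℕ

Vec-≗⇒≡ : ∀ {A : Set} (xs ys : Vec A n) → (∀ i → lookup xs i ≡ lookup ys i) → xs ≡ ys
Vec-≗⇒≡ xs ys xs≗ys = trans (sym (tabulate∘lookup xs)) (trans (tabulate-cong xs≗ys) (tabulate∘lookup ys))

⌊≟⌋-refl : (u : Fin n) → ⌊ u ≟ u ⌋ ≡ true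
⌊≟⌋-refl u = trans (isYes≗does (u ≟ u)) (dec-true (u ≟ u) refl)

⌊≟⌋-≢ : {u w : Fin n} → u ≢ w → ⌊ u ≟ w ⌋ ≡ false
⌊≟⌋-≢ {u = u} {w} u≢w = trans (isYes≗does (u ≟ w)) (dec-false (u ≟ w) u≢w)

-- Counting

indicator : Bool → ℕ
indicator true  = 1
indicator false = 0

count : (Fin n → Bool) → ℕ
count f = sum (indicator ∘ f)

_∖_ : (Fin n → Bool) → Fin n → Fin n → Bool
(f ∖ u) w = f w ∧ not ⌊ u ≟ w ⌋

count-cong : {f g : Fin n → Bool} → (∀ w → f w ≡ g w) → count f ≡ count g
count-cong f≗g = sum-cong-≗ (cong indicator ∘ f≗g)

count-false : count {n} (λ _ → false) ≡ 0
count-false {n} = sum-replicate-zero n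

count-mono : {f g : Fin n → Bool} → (∀ w → f w ≡ true → g w ≡ true) → count f ≤ count g
count-mono {zero}  f⊆g = z≤n
count-mono {suc n} f⊆g = +-mono-≤ (indicator-mono (f⊆g zero)) (count-mono (f⊆g ∘ suc))
  where
  indicator-mono : ∀ {a b} → (a ≡ true → b ≡ true) → indicator a ≤ indicator b
  indicator-mono {false} _   = z≤n
  indicator-mono {true}  a⇒b rewrite a⇒b refl = ≤-refl

count-split : (f g : Fin n → Bool) →
  count f ≡ count (λ w → f w ∧ g w) + count (λ w → f w ∧ not (g w))
count-split {zero}  f g = refl
count-split {suc n} f g =
  trans (cong₂ _+_ (indicator-split (f zero) (g zero)) (count-split (f ∘ suc) (g ∘ suc)))
        (interchange (indicator (f zero ∧ g zero)) (indicator (f zero ∧ not (g zero)))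
                     (count (λ w → f (suc w) ∧ g (suc w))) (count (λ w → f (suc w) ∧ not (g (suc w)))))
  where
  indicator-split : ∀ a b → indicator a ≡ indicator (a ∧ b) + indicator (a ∧ not b)
  indicator-split true  true  = refl
  indicator-split true  false = refl
  indicator-split false b     = refl

count-differ-at : (f g : Fin n → Bool) (u : Fin n) → f u ≡ true → g u ≡ false →
  (∀ w → w ≢ u → f w ≡ g w) → count f ≡ suc (count g)
count-differ-at f g zero fu gu f≗g rewrite fu | gu =
  cong suc (count-cong (λ w → f≗g (suc w) λ ()))
count-differ-at f g (suc u) fu gu f≗g = begin
  indicator (f zero) + count (f ∘ suc)
    ≡⟨ cong₂ _+_ (cong indicator (f≗g zero λ ()))
                 (count-differ-at (f ∘ suc) (g ∘ suc) u fu gu (λ w w≢u → f≗g (suc w) (w≢u ∘ Fin-suc-injective))) ⟩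
  indicator (g zero) + suc (count (g ∘ suc))
    ≡⟨ +-suc _ _ ⟩
  suc (count g) ∎
  where open ≡-Reasoning

count-∖ : (f : Fin n → Bool) (u : Fin n) → count f ≡ indicator (f u) + count (f ∖ u)
count-∖ f u with f u in fu
... | true  = count-differ-at f (f ∖ u) u fu u∉ (λ w w≢u → sym (kept w w≢u))
  where
  u∉ : (f ∖ u) u ≡ false
  u∉ rewrite ⌊≟⌋-refl u = ∧-zeroʳ (f u)
  kept : ∀ w → w ≢ u → (f ∖ u) w ≡ f w
  kept w w≢u rewrite ⌊≟⌋-≢ (w≢u ∘ sym) = ∧-identityʳ (f w)
... | false = count-cong kept
  where
  kept : ∀ w → f w ≡ (f ∖ u) w
  kept w with u ≟ w
  ... | yes refl rewrite fu = refl
  ... | no _     = sym (∧-identityʳ (f w))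

count>0⇒∃ : (f : Fin n → Bool) → 0 < count f → ∃ λ w → f w ≡ true
count>0⇒∃ {suc n} f pos with f zero in f0
... | true  = zero , f0
... | false with count>0⇒∃ (f ∘ suc) pos
...   | w , fw = suc w , fw

true⇒count>0 : (f : Fin n → Bool) (w : Fin n) → f w ≡ true → 0 < count f
true⇒count>0 f w fw =
  subst (0 <_) (sym (count-∖ f w)) (subst (λ b → 0 < indicator b + count (f ∖ w)) (sym fw) (s≤s z≤n))

count≡0⇒false : (f : Fin n → Bool) → count f ≡ 0 → ∀ w → f w ≡ false
count≡0⇒false f zero≡ w with f w in fw
... | false = refl
... | true  = ⊥-elim (<⇒≢ (true⇒count>0 f w fw) (sym zero≡))

count≡1⇒unique : (f : Fin n → Bool) → count f ≡ 1 →
  ∃ λ u → f u ≡ true × (∀ w → w ≢ u → f w ≡ false)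
count≡1⇒unique f one with count>0⇒∃ f (subst (0 <_) (sym one) (s≤s z≤n))
... | u , fu = u , fu , others
  where
  rest≡0 : count (f ∖ u) ≡ 0
  rest≡0 = suc-injective (trans (sym (cong (_+ count (f ∖ u)) (cong indicator fu))) (trans (sym (count-∖ f u)) one))
  others : ∀ w → w ≢ u → f w ≡ false
  others w w≢u = trans (sym (∧-identityʳ (f w))) (trans (cong (λ b → f w ∧ not b) (sym (⌊≟⌋-≢ (w≢u ∘ sym))))
                   (count≡0⇒false (f ∖ u) rest≡0 w))

count-choose : (f : Fin n → Bool) (m : ℕ) → m ≤ count f →
  Σ (Fin n → Bool) λ g → (∀ w → g w ≡ true → f w ≡ true) × count g ≡ m
count-choose {n} f zero _ = (λ _ → false) , (λ _ ()) , count-false {n}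
count-choose {suc n} f (suc m) m<c with f zero in f0
... | true with count-choose (f ∘ suc) m (≤-pred m<c)
...   | g , g⊆f , cg = (true ◂ g) , ⊆ , cong suc cg
  where
  ⊆ : ∀ w → (true ◂ g) w ≡ true → f w ≡ true
  ⊆ zero    _ = f0
  ⊆ (suc w) p = g⊆f w p
count-choose {suc n} f (suc m) m<c | false with count-choose (f ∘ suc) (suc m) m<c
...   | g , g⊆f , cg = (false ◂ g) , ⊆ , cg
  where
  ⊆ : ∀ w → (false ◂ g) w ≡ true → f w ≡ true
  ⊆ (suc w) p = g⊆f w p

∣S∣≡count : (S : Subset n) → ∣ S ∣ ≡ count (lookup S)
∣S∣≡count []          = refl
∣S∣≡count (true ∷ S)  = cong suc (∣S∣≡count S)
∣S∣≡count (false ∷ S) = ∣S∣≡count S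

sum-indicator-≟ : (a : Fin m) (b : Bool) → sum (λ l → indicator (⌊ a ≟ l ⌋ ∧ b)) ≡ indicator b
sum-indicator-≟ {m} a false = trans (sum-cong-≗ (λ l → cong indicator (∧-zeroʳ ⌊ a ≟ l ⌋))) (sum-replicate-zero m)
sum-indicator-≟ a true = trans (sum-cong-≗ (λ l → cong indicator (∧-identityʳ ⌊ a ≟ l ⌋))) (sum-δ a)
  where
  sum-δ : ∀ {m} (a : Fin m) → sum (λ l → indicator ⌊ a ≟ l ⌋) ≡ 1
  sum-δ {suc m} zero    = cong suc (sum-replicate-zero m)
  sum-δ {suc m} (suc a) = trans (sum-cong-≗ {m} λ l →
    cong indicator (trans (isYes≗does (suc a ≟ suc l)) (sym (isYes≗does (a ≟ l))))) (sum-δ a)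

count-partition : (ty : Fin n → Fin m) (f : Fin n → Bool) →
  count f ≡ sum (λ l → count (λ w → ⌊ ty w ≟ l ⌋ ∧ f w))
count-partition ty f = trans (sum-cong-≗ (λ w → sym (sum-indicator-≟ (ty w) (f w))))
                             (∑-comm (λ w l → indicator (⌊ ty w ≟ l ⌋ ∧ f w)))

sum-<⇒∃< : (f g : Fin m → ℕ) → sum f < sum g → ∃ λ l → f l < g l
sum-<⇒∃< {suc m} f g lt with f zero <? g zero
... | yes f0<g0 = zero , f0<g0
... | no  f0≮g0 with sum-<⇒∃< (f ∘ suc) (g ∘ suc) (+-cancelˡ-< (g zero) _ _ (≤-<-trans (+-monoˡ-≤ _ (≮⇒≥ f0≮g0)) lt))
...   | l , fl<gl = suc l , fl<gl

count-∧-not : (f g h : Fin n → Bool) → (∀ w → (f w ∧ g w) ≡ h w) →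
  count (λ w → f w ∧ not (g w)) ≡ count f ∸ count h
count-∧-not f g h f∧g≗h = sym (begin
  count f ∸ count h                                              ≡⟨ cong (_∸ count h) (count-split f g) ⟩
  count (λ w → f w ∧ g w) + count (λ w → f w ∧ not (g w)) ∸ count h ≡⟨ cong (λ a → a + _ ∸ count h) (count-cong f∧g≗h) ⟩
  count h + count (λ w → f w ∧ not (g w)) ∸ count h              ≡⟨ m+n∸m≡n (count h) _ ⟩
  count (λ w → f w ∧ not (g w))                                  ∎)
  where open ≡-Reasoning

unique⇒count≡1 : (f : Fin n → Bool) (u : Fin n) → f u ≡ true → (∀ w → w ≢ u → f w ≡ false) → count f ≡ 1
unique⇒count≡1 {n} f u fu others = trans (count-differ-at f (λ _ → false) u fu refl others) (cong suc (count-false {n}))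

-- The back-and-forth argument

infix 4 _≈[_]_

_≈[_]_ : ℕ → ℕ → ℕ → Set
a ≈[ B ] b = a ≡ b ⊎ (B ≤ a × B ≤ b)

≈-sym : ∀ {B a b} → a ≈[ B ] b → b ≈[ B ] a
≈-sym (inj₁ a≡b)       = inj₁ (sym a≡b)
≈-sym (inj₂ (B≤a , B≤b)) = inj₂ (B≤b , B≤a)

≈-weaken : ∀ {B B' a b} → B' ≤ B → a ≈[ B ] b → a ≈[ B' ] b
≈-weaken _    (inj₁ a≡b)       = inj₁ a≡b
≈-weaken B'≤B (inj₂ (B≤a , B≤b)) = inj₂ (≤-trans B'≤B B≤a , ≤-trans B'≤B B≤b)

≈-cancelˡ : ∀ {B a b} d → d + a ≈[ d + B ] d + b → a ≈[ B ] b
≈-cancelˡ d (inj₁ e)         = inj₁ (+-cancelˡ-≡ d _ _ e)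
≈-cancelˡ d (inj₂ (p , q)) = inj₂ (+-cancelˡ-≤ d _ _ p , +-cancelˡ-≤ d _ _ q)

-- Why the threshold halves at each set quantifier.
≈-split : ∀ h a₁ a₂ b → a₁ + a₂ ≈[ h + h ] b →
  Σ ℕ λ τ → τ ≤ b × a₁ ≈[ h ] τ × a₂ ≈[ h ] b ∸ τ
≈-split h a₁ a₂ b (inj₁ e) =
  a₁ , subst (a₁ ≤_) e (m≤m+n a₁ a₂) , inj₁ refl , inj₁ (sym (trans (cong (_∸ a₁) (sym e)) (m+n∸m≡n a₁ a₂)))
≈-split h a₁ a₂ b (inj₂ (2h≤a , 2h≤b)) with a₁ <? h | a₂ <? h
... | yes a₁<h | _ = a₁ , ≤-trans (<⇒≤ a₁<h) h≤b , inj₁ refl ,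
  inj₂ (h≤a₂ , m+n≤o⇒m≤o∸n h (≤-trans (+-monoʳ-≤ h (<⇒≤ a₁<h)) 2h≤b))
  where
  h≤b = ≤-trans (m≤m+n h h) 2h≤b
  h≤a₂ : h ≤ a₂
  h≤a₂ with a₂ <? h
  ... | yes a₂<h = ⊥-elim (<⇒≱ (+-mono-< a₁<h a₂<h) 2h≤a)
  ... | no a₂≮h  = ≮⇒≥ a₂≮h
... | no a₁≮h | yes a₂<h = b ∸ a₂ , m∸n≤m b a₂ ,
  inj₂ (≮⇒≥ a₁≮h , m+n≤o⇒m≤o∸n h (≤-trans (+-monoʳ-≤ h (<⇒≤ a₂<h)) 2h≤b)) ,
  inj₁ (sym (m∸[m∸n]≡n (≤-trans (<⇒≤ a₂<h) (≤-trans (m≤m+n h h) 2h≤b))))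
... | no a₁≮h | no a₂≮h = h , ≤-trans (m≤m+n h h) 2h≤b , inj₂ (≮⇒≥ a₁≮h , ≤-refl) ,
  inj₂ (≮⇒≥ a₂≮h , m+n≤o⇒m≤o∸n h 2h≤b)

≈-split-count : ∀ {n'} h (f g : Fin n → Bool) (f' : Fin n' → Bool) → count f ≈[ h + h ] count f' →
  Σ (Fin n' → Bool) λ Q → (∀ w → Q w ≡ true → f' w ≡ true)
    × count (λ w → f w ∧ g w) ≈[ h ] count Q × count (λ w → f w ∧ not (g w)) ≈[ h ] count f' ∸ count Q
≈-split-count h f g f' f≈f' with ≈-split h _ _ _ (subst (_≈[ h + h ] count f') (count-split f g) f≈f')
... | τ , τ≤ , ≈₁ , ≈₂ with count-choose f' τ τ≤
...   | Q , Q⊆f' , refl = Q , Q⊆f' , ≈₁ , ≈₂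

_==_ : Bool → Bool → Bool
true  == b = b
false == b = not b

_==ᵛ_ : Vec Bool k → Vec Bool k → Bool
[]      ==ᵛ []      = true
(a ∷ u) ==ᵛ (b ∷ v) = (a == b) ∧ (u ==ᵛ v)

==-true : ∀ x → (x == true) ≡ x
==-true true  = refl
==-true false = refl

==-false : ∀ x → (x == false) ≡ not x
==-false true  = refl
==-false false = refl

==ᵛ-refl : (u : Vec Bool k) → (u ==ᵛ u) ≡ true
==ᵛ-refl []          = refl
==ᵛ-refl (true ∷ u)  = ==ᵛ-refl u
==ᵛ-refl (false ∷ u) = ==ᵛ-refl u

==ᵛ⇒≡ : (u v : Vec Bool k) → (u ==ᵛ v) ≡ true → u ≡ v
==ᵛ⇒≡ []          []          _ = refl
==ᵛ⇒≡ (true ∷ u)  (true ∷ v)  e = cong (true ∷_) (==ᵛ⇒≡ u v e)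
==ᵛ⇒≡ (false ∷ u) (false ∷ v) e = cong (false ∷_) (==ᵛ⇒≡ u v e)

occurs : Vec (Fin n) k → Fin n → Bool
occurs []      w = false
occurs (v ∷ ρ) w = ⌊ v ≟ w ⌋ ∨ occurs ρ w

occurs-lookup : (ρ : Vec (Fin n) k) (x : Fin k) → occurs ρ (lookup ρ x) ≡ true
occurs-lookup (v ∷ ρ) zero rewrite ⌊≟⌋-refl v = refl
occurs-lookup (v ∷ ρ) (suc x) with ⌊ v ≟ lookup ρ x ⌋
... | true  = refl
... | false = occurs-lookup ρ x

¬occurs⇒≢ : (ρ : Vec (Fin n) k) {w : Fin n} → occurs ρ w ≡ false → ∀ x → lookup ρ x ≢ w
¬occurs⇒≢ ρ ¬occ x refl with () ← trans (sym (occurs-lookup ρ x)) ¬occ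

occurs? : (ρ : Vec (Fin n) k) (w : Fin n) → (∃ λ x → lookup ρ x ≡ w) ⊎ occurs ρ w ≡ false
occurs? []      w = inj₂ refl
occurs? (v ∷ ρ) w with v ≟ w
... | yes v≡w = inj₁ (zero , v≡w)
... | no  _ with occurs? ρ w
...   | inj₁ (x , e) = inj₁ (suc x , e)
...   | inj₂ ¬occ    = inj₂ ¬occ

occurs-∷-lookup : (ρ : Vec (Fin n) k) (x : Fin k) (w : Fin n) → occurs (lookup ρ x ∷ ρ) w ≡ occurs ρ w
occurs-∷-lookup ρ x w with lookup ρ x ≟ w
... | yes refl = sym (occurs-lookup ρ x)
... | no  _    = refl

module _ {n c : ℕ} (G : ColoredGraph n c) (P : TypePartition G) where
  open ColoredGraph G using (adj; irrefl)
  open TypePartition P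

  same-type⇒adj≡ : ∀ u u' w → ty u ≡ ty u' → u ≢ w → u' ≢ w → adj u w ≡ adj u' w
  same-type⇒adj≡ u u' w tu≡tu' u≢w u'≢w with proj₁ (Equivalence.to (correct u u') tu≡tu')
  ... | inj₁ open-twins   = open-twins w
  ... | inj₂ closed-twins = closed⇒open (closed-twins w)
    where
    closed⇒open : cadj G u w ≡ cadj G u' w → adj u w ≡ adj u' w
    closed⇒open e rewrite ⌊≟⌋-≢ u≢w | ⌊≟⌋-≢ u'≢w = e

  adj-respects-type : ∀ u u' v v' → ty u ≡ ty u' → ty v ≡ ty v' → u ≢ v → u' ≢ v' →
    adj u v ≡ adj u' v'
  adj-respects-type u u' v v' tu tv u≢v u'≢v' with v ≟ u'
  ... | no v≢u' = begin
    adj u v   ≡⟨ same-type⇒adj≡ u u' v tu u≢v (v≢u' ∘ sym) ⟩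
    adj u' v  ≡⟨ ColoredGraph.sym G u' v ⟩
    adj v u'  ≡⟨ same-type⇒adj≡ v v' u' tv v≢u' (u'≢v' ∘ sym) ⟩
    adj v' u' ≡⟨ ColoredGraph.sym G v' u' ⟩
    adj u' v' ∎
    where open ≡-Reasoning
  ... | yes refl with u ≟ v'
  ...   | yes refl = ColoredGraph.sym G u v
  ...   | no u≢v'  = begin
    adj u v   ≡⟨ same-type⇒adj≡ u v' v (trans tu tv) u≢v (u'≢v' ∘ sym) ⟩
    adj v' v  ≡⟨ ColoredGraph.sym G v' v ⟩
    adj v v'  ∎
    where open ≡-Reasoning

  membership : ∀ {ns} → Vec (Subset n) ns → Fin n → Vec Bool ns
  membership η w = map (λ S → lookup S w) η

  cell : ∀ {nv ns} → Vec (Fin n) nv → Vec (Subset n) ns → Fin t → Vec Bool ns → Fin n → Bool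
  cell ρ η i p w = ⌊ ty w ≟ i ⌋ ∧ ((membership η w ==ᵛ p) ∧ not (occurs ρ w))

  record Similar {nv ns} (B : ℕ) (ρ : Vec (Fin n) nv) (η : Vec (Subset n) ns)
                 (ρ' : Vec (Fin n) nv) (η' : Vec (Subset n) ns) : Set where
    field
      type≡       : ∀ x → ty (lookup ρ x) ≡ ty (lookup ρ' x)
      ≡⇒≡         : ∀ x y → lookup ρ x ≡ lookup ρ y → lookup ρ' x ≡ lookup ρ' y
      ≡⇐≡         : ∀ x y → lookup ρ' x ≡ lookup ρ' y → lookup ρ x ≡ lookup ρ y
      membership≡ : ∀ x → membership η (lookup ρ x) ≡ membership η' (lookup ρ' x)
      cells≈      : ∀ i p → count (cell ρ η i p) ≈[ B ] count (cell ρ' η' i p)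
  open Similar

  module _ {nv ns : ℕ} {ρ ρ' : Vec (Fin n) nv} {η η' : Vec (Subset n) ns} where

    Similar-sym : ∀ {B} → Similar B ρ η ρ' η' → Similar B ρ' η' ρ η
    Similar-sym R = record
      { type≡ = sym ∘ type≡ R ; ≡⇒≡ = ≡⇐≡ R ; ≡⇐≡ = ≡⇒≡ R
      ; membership≡ = sym ∘ membership≡ R ; cells≈ = λ i p → ≈-sym (cells≈ R i p) }

    Similar-weaken : ∀ {B B'} → B' ≤ B → Similar B ρ η ρ' η' → Similar B' ρ η ρ' η'
    Similar-weaken B'≤B R = record
      { type≡ = type≡ R ; ≡⇒≡ = ≡⇒≡ R ; ≡⇐≡ = ≡⇐≡ R
      ; membership≡ = membership≡ R ; cells≈ = λ i p → ≈-weaken B'≤B (cells≈ R i p) }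

    ∷-Similar : ∀ {B B'} {v v'} → Similar B ρ η ρ' η' → ty v ≡ ty v' → membership η v ≡ membership η' v' →
      (∀ x → lookup ρ x ≡ v → lookup ρ' x ≡ v') → (∀ x → lookup ρ' x ≡ v' → lookup ρ x ≡ v) →
      (∀ i p → count (cell (v ∷ ρ) η i p) ≈[ B' ] count (cell (v' ∷ ρ') η' i p)) →
      Similar B' (v ∷ ρ) η (v' ∷ ρ') η'
    ∷-Similar {v = v} {v'} R tv mv ⇒v' ⇐v cells = record
      { type≡ = λ { zero → tv ; (suc x) → type≡ R x }
      ; ≡⇒≡ = λ { zero zero _ → refl ; zero (suc y) e → sym (⇒v' y (sym e))
                ; (suc x) zero e → ⇒v' x e ; (suc x) (suc y) e → ≡⇒≡ R x y e }
      ; ≡⇐≡ = λ { zero zero _ → refl ; zero (suc y) e → sym (⇐v y (sym e))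
                ; (suc x) zero e → ⇐v x e ; (suc x) (suc y) e → ≡⇐≡ R x y e }
      ; membership≡ = λ { zero → mv ; (suc x) → membership≡ R x }
      ; cells≈ = cells }

  cell≡true : ∀ {nv ns} (ρ : Vec (Fin n) nv) (η : Vec (Subset n) ns) i p w → cell ρ η i p w ≡ true →
    ty w ≡ i × membership η w ≡ p × occurs ρ w ≡ false
  cell≡true ρ η i p w e with ty w ≟ i | membership η w ==ᵛ p in eq | occurs ρ w
  ... | yes tw≡i | true | false = tw≡i , ==ᵛ⇒≡ _ _ eq , refl

  count-cell-∷ᵛ : ∀ {nv ns} (ρ : Vec (Fin n) nv) (η : Vec (Subset n) ns) i p u →
    count (cell ρ η i p) ≡ indicator (cell ρ η i p u) + count (cell (u ∷ ρ) η i p)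
  count-cell-∷ᵛ ρ η i p u =
    trans (count-∖ (cell ρ η i p) u) (cong (indicator (cell ρ η i p u) +_) (count-cong λ w →
      ∧-not-∨ ⌊ ty w ≟ i ⌋ (membership η w ==ᵛ p) ⌊ u ≟ w ⌋ (occurs ρ w)))
    where
    ∧-not-∨ : ∀ a b x y → ((a ∧ (b ∧ not y)) ∧ not x) ≡ (a ∧ (b ∧ not (x ∨ y)))
    ∧-not-∨ true true true y = ∧-zeroʳ (not y)
    ∧-not-∨ true true false y = ∧-identityʳ (not y)
    ∧-not-∨ true false x y = refl
    ∧-not-∨ false b x y = refl

  count-cell-∷ˢ : ∀ {nv ns} (ρ : Vec (Fin n) nv) (η : Vec (Subset n) ns) Z i b p →
    count (cell ρ (Z ∷ η) i (b ∷ p)) ≡ count (λ w → cell ρ η i p w ∧ (lookup Z w == b))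
  count-cell-∷ˢ ρ η Z i b p = count-cong λ w →
    ∧-shuffle ⌊ ty w ≟ i ⌋ (lookup Z w == b) (membership η w ==ᵛ p) (not (occurs ρ w))
    where
    ∧-shuffle : ∀ a x e o → (a ∧ ((x ∧ e) ∧ o)) ≡ ((a ∧ (e ∧ o)) ∧ x)
    ∧-shuffle false x     e o = refl
    ∧-shuffle true  true  e o = sym (∧-identityʳ (e ∧ o))
    ∧-shuffle true  false e o = sym (∧-zeroʳ (e ∧ o))

  module _ {nv ns : ℕ} {ρ ρ' : Vec (Fin n) nv} {η η' : Vec (Subset n) ns} where

    extend-by-assigned : ∀ {B} x → Similar B ρ η ρ' η' → Similar B (lookup ρ x ∷ ρ) η (lookup ρ' x ∷ ρ') η'
    extend-by-assigned {B} x R =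
      ∷-Similar R (type≡ R x) (membership≡ R x) (λ y e → ≡⇒≡ R y x e) (λ y e → ≡⇐≡ R y x e) λ i p →
        subst₂ (_≈[ B ]_)
          (count-cong λ w → cong (λ o → ⌊ ty w ≟ i ⌋ ∧ ((membership η w ==ᵛ p) ∧ not o)) (sym (occurs-∷-lookup ρ x w)))
          (count-cong λ w → cong (λ o → ⌊ ty w ≟ i ⌋ ∧ ((membership η' w ==ᵛ p) ∧ not o)) (sym (occurs-∷-lookup ρ' x w)))
          (cells≈ R i p)

    -- v' is any vertex of the cell of v on the other side, which is nonempty because B ≥ 1.
    extend-by-unassigned : ∀ s r → Similar (2 ^ s * suc r) ρ η ρ' η' →
      ∀ v → occurs ρ v ≡ false → ∃ λ v' → Similar (2 ^ s * r) (v ∷ ρ) η (v' ∷ ρ') η'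
    extend-by-unassigned s r R v v∉ρ = v' , ∷-Similar R (sym tv') (sym mv')
      (λ x e → ⊥-elim (¬occurs⇒≢ ρ v∉ρ x e)) (λ x e → ⊥-elim (¬occurs⇒≢ ρ' v'∉ρ' x e)) cells
      where
      v∈cell : cell ρ η (ty v) (membership η v) v ≡ true
      v∈cell rewrite ⌊≟⌋-refl (ty v) | ==ᵛ-refl (membership η v) | v∉ρ = refl
      cell'-nonempty : 0 < count (cell ρ' η' (ty v) (membership η v))
      cell'-nonempty with cells≈ R (ty v) (membership η v)
      ... | inj₁ e = subst (0 <_) e (true⇒count>0 _ v v∈cell)
      ... | inj₂ (_ , B≤c') = ≤-trans (*-mono-≤ (m^n>0 2 s) (s≤s z≤n)) B≤c'
      v'-pick = count>0⇒∃ _ cell'-nonempty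
      v' = proj₁ v'-pick
      tv' = proj₁ (cell≡true ρ' η' _ _ v' (proj₂ v'-pick))
      mv' = proj₁ (proj₂ (cell≡true ρ' η' _ _ v' (proj₂ v'-pick)))
      v'∉ρ' = proj₂ (proj₂ (cell≡true ρ' η' _ _ v' (proj₂ v'-pick)))
      same-cell : ∀ i p → cell ρ' η' i p v' ≡ cell ρ η i p v
      same-cell i p rewrite tv' | mv' | v'∉ρ' | v∉ρ = refl
      indicator≤1 : ∀ b → indicator b ≤ 1
      indicator≤1 true  = ≤-refl
      indicator≤1 false = z≤n
      cells : ∀ i p → count (cell (v ∷ ρ) η i p) ≈[ 2 ^ s * r ] count (cell (v' ∷ ρ') η' i p)
      cells i p = ≈-cancelˡ (indicator b) (subst₂ (_≈[ indicator b + 2 ^ s * r ]_)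
        (count-cell-∷ᵛ ρ η i p v)
        (trans (count-cell-∷ᵛ ρ' η' i p v') (cong (λ z → indicator z + count (cell (v' ∷ ρ') η' i p)) (same-cell i p)))
        (≈-weaken bound (cells≈ R i p)))
        where
        b = cell ρ η i p v
        bound : indicator b + 2 ^ s * r ≤ 2 ^ s * suc r
        bound = subst (indicator b + 2 ^ s * r ≤_) (sym (*-suc (2 ^ s) r))
                  (+-monoˡ-≤ (2 ^ s * r) (≤-trans (indicator≤1 b) (m^n>0 2 s)))

    extend-vertex : ∀ s r → Similar (2 ^ s * suc r) ρ η ρ' η' →
      ∀ v → ∃ λ v' → Similar (2 ^ s * r) (v ∷ ρ) η (v' ∷ ρ') η'
    extend-vertex s r R v with occurs? ρ v
    ... | inj₁ (x , refl) = lookup ρ' x , extend-by-assigned x (Similar-weaken (*-monoʳ-≤ (2 ^ s) (n≤1+n r)) R)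
    ... | inj₂ v∉ρ        = extend-by-unassigned s r R v v∉ρ

    extend-set : ∀ s r → Similar (2 ^ suc s * r) ρ η ρ' η' →
      ∀ X → ∃ λ Y → Similar (2 ^ s * r) ρ (X ∷ η) ρ' (Y ∷ η')
    extend-set s r R X = Y , record
      { type≡ = type≡ R ; ≡⇒≡ = ≡⇒≡ R ; ≡⇐≡ = ≡⇐≡ R ; membership≡ = membership≡-Y ; cells≈ = cells }
      where
      h = 2 ^ s * r
      2h≡ : 2 ^ suc s * r ≡ h + h
      2h≡ = trans (*-assoc 2 (2 ^ s) r) (cong (h +_) (+-identityʳ h))
      part : ∀ i p → Σ (Fin n → Bool) λ Q → (∀ w → Q w ≡ true → cell ρ' η' i p w ≡ true)
        × count (λ w → cell ρ η i p w ∧ lookup X w) ≈[ h ] count Q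
        × count (λ w → cell ρ η i p w ∧ not (lookup X w)) ≈[ h ] count (cell ρ' η' i p) ∸ count Q
      part i p = ≈-split-count h (cell ρ η i p) (lookup X) (cell ρ' η' i p)
        (subst (λ B → count (cell ρ η i p) ≈[ B ] count (cell ρ' η' i p)) 2h≡ (cells≈ R i p))
      -- Y copies X on the vertices of ρ' and takes the chosen part of every cell elsewhere.
      chosen : Fin n → Bool
      chosen w with occurs? ρ' w
      ... | inj₁ (x , _) = lookup X (lookup ρ x)
      ... | inj₂ _       = proj₁ (part (ty w) (membership η' w)) w
      Y : Subset n
      Y = tabulate chosen
      chosen-on-ρ' : ∀ x → chosen (lookup ρ' x) ≡ lookup X (lookup ρ x)
      chosen-on-ρ' x with occurs? ρ' (lookup ρ' x)
      ... | inj₁ (x' , e) = cong (lookup X) (≡⇐≡ R x' x e)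
      ... | inj₂ ¬occ     = ⊥-elim (¬occurs⇒≢ ρ' ¬occ x refl)
      membership≡-Y : ∀ x → membership (X ∷ η) (lookup ρ x) ≡ membership (Y ∷ η') (lookup ρ' x)
      membership≡-Y x = cong₂ _∷_ (sym (trans (lookup∘tabulate chosen (lookup ρ' x)) (chosen-on-ρ' x))) (membership≡ R x)
      Y-on-cell : ∀ i p w → (cell ρ' η' i p w ∧ lookup Y w) ≡ proj₁ (part i p) w
      Y-on-cell i p w with cell ρ' η' i p w in w∈
      ... | true with cell≡true ρ' η' i p w w∈
      ...   | refl , refl , w∉ρ' rewrite lookup∘tabulate chosen w with occurs? ρ' w
      ...     | inj₁ (x , e) = ⊥-elim (¬occurs⇒≢ ρ' w∉ρ' x e)
      ...     | inj₂ _       = refl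
      Y-on-cell i p w | false with proj₁ (part i p) w in w∈Q
      ... | false = refl
      ... | true with () ← trans (sym (proj₁ (proj₂ (part i p)) w w∈Q)) w∈
      cells : ∀ i p → count (cell ρ (X ∷ η) i p) ≈[ h ] count (cell ρ' (Y ∷ η') i p)
      cells i (true ∷ p) = subst₂ (_≈[ h ]_)
        (sym (trans (count-cell-∷ˢ ρ η X i true p) (count-cong λ w → cong (cell ρ η i p w ∧_) (==-true (lookup X w)))))
        (sym (trans (count-cell-∷ˢ ρ' η' Y i true p) (count-cong λ w →
          trans (cong (cell ρ' η' i p w ∧_) (==-true (lookup Y w))) (Y-on-cell i p w))))
        (proj₁ (proj₂ (proj₂ (part i p))))
      cells i (false ∷ p) = subst₂ (_≈[ h ]_)
        (sym (trans (count-cell-∷ˢ ρ η X i false p) (count-cong λ w → cong (cell ρ η i p w ∧_) (==-false (lookup X w)))))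
        (sym (trans (count-cell-∷ˢ ρ' η' Y i false p) (count-cong λ w → cong (cell ρ' η' i p w ∧_) (==-false (lookup Y w)))))
        (subst (count (λ w → cell ρ η i p w ∧ not (lookup X w)) ≈[ h ]_)
          (sym (count-∧-not (cell ρ' η' i p) (lookup Y) _ (Y-on-cell i p))) (proj₂ (proj₂ (proj₂ (part i p)))))

  weight-≤ˡ : ∀ a a' b b' → 2 ^ a * b ≤ 2 ^ (a + a') * (b + b')
  weight-≤ˡ a a' b b' = *-mono-≤ (^-monoʳ-≤ 2 (m≤m+n a a')) (m≤m+n b b')

  weight-≤ʳ : ∀ a a' b b' → 2 ^ a' * b' ≤ 2 ^ (a + a') * (b + b')
  weight-≤ʳ a a' b b' = *-mono-≤ (^-monoʳ-≤ 2 (m≤n+m a' a)) (m≤n+m b' b)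

  Similar-Sat : ∀ {nv ns} (φ : Formula c nv ns) {ρ η ρ' η'} →
    Similar (qOf φ) ρ η ρ' η' → Sat G φ ρ η → Sat G φ ρ' η'
  Similar-Sat (eq x y) R s = ≡⇒≡ R x y s
  Similar-Sat (edge x y) {ρ} {η} {ρ'} R s with lookup ρ' x ≟ lookup ρ' y
  ... | yes e with () ← trans (sym s) (trans (cong (adj (lookup ρ x)) (sym (≡⇐≡ R x y e))) (irrefl (lookup ρ x)))
  ... | no ne = trans (sym (adj-respects-type _ _ _ _ (type≡ R x) (type≡ R y) (ne ∘ ≡⇒≡ R x y) ne)) s
  Similar-Sat (col i x) {ρ} {η} {ρ'} R s =
    Equivalence.to (proj₂ (Equivalence.to (correct (lookup ρ x) (lookup ρ' x)) (type≡ R x)) i) s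
  Similar-Sat (mem x X) {ρ} {η} {ρ'} {η'} R s = lookup⇒[]= (lookup ρ' x) (lookup η' X) (begin
    lookup (lookup η' X) (lookup ρ' x)       ≡⟨ lookup-map X (λ S → lookup S (lookup ρ' x)) η' ⟨
    lookup (membership η' (lookup ρ' x)) X  ≡⟨ cong (λ m → lookup m X) (membership≡ R x) ⟨
    lookup (membership η (lookup ρ x)) X    ≡⟨ lookup-map X (λ S → lookup S (lookup ρ x)) η ⟩
    lookup (lookup η X) (lookup ρ x)         ≡⟨ []=⇒lookup s ⟩
    true                                     ∎)
    where open ≡-Reasoning
  Similar-Sat (¬' φ) R s s' = s (Similar-Sat φ (Similar-sym R) s')
  Similar-Sat (φ ∧' ψ) R (s₁ , s₂) =
    Similar-Sat φ (Similar-weaken (weight-≤ˡ (qs φ) (qs ψ) (qv φ) (qv ψ)) R) s₁ ,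
    Similar-Sat ψ (Similar-weaken (weight-≤ʳ (qs φ) (qs ψ) (qv φ) (qv ψ)) R) s₂
  Similar-Sat (φ ∨' ψ) R (inj₁ s₁) = inj₁ (Similar-Sat φ (Similar-weaken (weight-≤ˡ (qs φ) (qs ψ) (qv φ) (qv ψ)) R) s₁)
  Similar-Sat (φ ∨' ψ) R (inj₂ s₂) = inj₂ (Similar-Sat ψ (Similar-weaken (weight-≤ʳ (qs φ) (qs ψ) (qv φ) (qv ψ)) R) s₂)
  Similar-Sat (φ ⇒' ψ) R f s₁ =
    Similar-Sat ψ (Similar-weaken (weight-≤ʳ (qs φ) (qs ψ) (qv φ) (qv ψ)) R)
      (f (Similar-Sat φ (Similar-sym (Similar-weaken (weight-≤ˡ (qs φ) (qs ψ) (qv φ) (qv ψ)) R)) s₁))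
  Similar-Sat (∃v φ) R (v , s) with extend-vertex (qs φ) (qv φ) R v
  ... | v' , R' = v' , Similar-Sat φ R' s
  Similar-Sat (∀v φ) R f v' with extend-vertex (qs φ) (qv φ) (Similar-sym R) v'
  ... | v , R' = Similar-Sat φ (Similar-sym R') (f v)
  Similar-Sat (∃s φ) R (X , s) with extend-set (qs φ) (qv φ) R X
  ... | Y , R' = Y , Similar-Sat φ R' s
  Similar-Sat (∀s φ) R f Y with extend-set (qs φ) (qv φ) (Similar-sym R) Y
  ... | X , R' = Similar-Sat φ (Similar-sym R') (f X)

module Shapes {n c : ℕ} (G : ColoredGraph n c) (φ : Formula c 0 1) (P : TypePartition G) where
  open TypePartition P

  qφ : ℕ
  qφ = q G φ P

  entry : ℕ → ℕ → Maybe ℕ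
  entry = shapeEntry G φ P

  σ : Subset n → Fin t → ℕ
  σ = sig G φ P

  ∣V∣ : Fin t → ℕ
  ∣V∣ = size G φ P

  shape : Subset n → Shape G φ P
  shape = shapeOf G φ P

  -- The range of counts that a shape records as ⊥.
  Middle : ℕ → ℕ → Set
  Middle s m = qφ ≤ s × s ≤ m ∸ qφ

  entry-cases : ∀ s m → (entry s m ≡ nothing × Middle s m) ⊎ (entry s m ≡ just s × ¬ Middle s m)
  entry-cases s m with qφ ≤? s | s ≤? m ∸ qφ
  ... | yes q≤s | yes s≤m∸q = inj₁ (refl , q≤s , s≤m∸q)
  ... | yes _   | no  s≰m∸q = inj₂ (refl , s≰m∸q ∘ proj₂)
  ... | no  q≰s | _         = inj₂ (refl , q≰s ∘ proj₁)

  entry≡just⇒≡ : ∀ {s m a} → entry s m ≡ just a → s ≡ a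
  entry≡just⇒≡ {s} {m} e with entry-cases s m
  ... | inj₂ (e' , _) = just-injective (trans (sym e') e)
  ... | inj₁ (e' , _) with () ← trans (sym e') e

  entry≡nothing⇒Middle : ∀ {s m} → entry s m ≡ nothing → Middle s m
  entry≡nothing⇒Middle {s} {m} e with entry-cases s m
  ... | inj₁ (_ , mid) = mid
  ... | inj₂ (e' , _) with () ← trans (sym e') e

  Middle⇒entry≡nothing : ∀ {s m} → Middle s m → entry s m ≡ nothing
  Middle⇒entry≡nothing {s} {m} mid with entry-cases s m
  ... | inj₁ (e , _)    = e
  ... | inj₂ (_ , ¬mid) = ⊥-elim (¬mid mid)

  Middle⇒entry≡ : ∀ {s s' m} → Middle s m → Middle s' m → entry s m ≡ entry s' m
  Middle⇒entry≡ mid mid' = trans (Middle⇒entry≡nothing mid) (sym (Middle⇒entry≡nothing mid'))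

  Middle⇒q≤m : ∀ {s m} → Middle s m → qφ ≤ m
  Middle⇒q≤m {m = m} (q≤s , s≤m∸q) = ≤-trans q≤s (≤-trans s≤m∸q (m∸n≤m m qφ))

  entry≡⇒Middle : ∀ {s s' m} → entry s m ≡ entry s' m → s ≢ s' → Middle s m × Middle s' m
  entry≡⇒Middle {s} {s'} {m} e s≢s' with entry-cases s m | entry-cases s' m
  ... | inj₁ (_ , mid) | inj₁ (_ , mid') = mid , mid'
  ... | inj₂ (e₁ , _)  | inj₂ (e₂ , _)   = ⊥-elim (s≢s' (just-injective (trans (sym e₁) (trans e e₂))))
  ... | inj₁ (e₁ , _)  | inj₂ (e₂ , _)   with () ← trans (sym e₁) (trans e e₂)
  ... | inj₂ (e₁ , _)  | inj₁ (e₂ , _)   with () ← trans (sym e₁) (trans e e₂)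

  entry≡⇒≈ : ∀ {s s' m} → entry s m ≡ entry s' m → s ≈[ qφ ] s' × m ∸ s ≈[ qφ ] m ∸ s'
  entry≡⇒≈ {s} {s'} {m} e with s ≟ℕ s'
  ... | yes refl = inj₁ refl , inj₁ refl
  ... | no s≢s' with entry≡⇒Middle e s≢s'
  ...   | mid , mid' = inj₂ (proj₁ mid , proj₁ mid') , inj₂ (complement mid , complement mid')
    where
    complement : ∀ {x} → Middle x m → qφ ≤ m ∸ x
    complement {x} mid@(q≤x , x≤m∸q) =
      m+n≤o⇒m≤o∸n qφ (subst (_≤ m) (+-comm x qφ) (m≤o∸n⇒m+n≤o x (Middle⇒q≤m mid) x≤m∸q))

  entry-between : ∀ {a b s m} → entry a m ≡ entry b m → a ≤ s → s ≤ b → entry s m ≡ entry a m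
  entry-between {a} {b} {s} {m} e a≤s s≤b with a ≟ℕ b
  ... | yes refl = cong (λ x → entry x m) (≤-antisym s≤b a≤s)
  ... | no a≢b with entry≡⇒Middle e a≢b
  ...   | mid-a@(q≤a , _) , (_ , b≤m∸q) = Middle⇒entry≡ (≤-trans q≤a a≤s , ≤-trans s≤b b≤m∸q) mid-a

  isType : Fin t → Fin n → Bool
  isType i w = ⌊ ty w ≟ i ⌋

  isType⇒≡ : ∀ {l w} → isType l w ≡ true → ty w ≡ l
  isType⇒≡ {l} {w} e with ty w ≟ l
  ... | yes tw≡l = tw≡l

  σ≡count : ∀ X i → σ X i ≡ count (λ w → isType i w ∧ lookup X w)
  σ≡count X i = trans (∣S∣≡count (block G φ P i ∩ X)) (count-cong λ w →
    trans (lookup-zipWith _∧_ w (block G φ P i) X) (cong (_∧ lookup X w) (lookup∘tabulate (isType i) w)))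

  ∣V∣≡count : ∀ i → ∣V∣ i ≡ count (isType i)
  ∣V∣≡count i = trans (∣S∣≡count (block G φ P i)) (count-cong (lookup∘tabulate (isType i)))

  ∣V∣≡σ+outside : ∀ X i → ∣V∣ i ≡ σ X i + count (λ w → isType i w ∧ not (lookup X w))
  ∣V∣≡σ+outside X i = trans (∣V∣≡count i) (trans (count-split (isType i) (lookup X))
    (cong (_+ count (λ w → isType i w ∧ not (lookup X w))) (sym (σ≡count X i))))

  ∣V∣∸σ≡outside : ∀ X i → ∣V∣ i ∸ σ X i ≡ count (λ w → isType i w ∧ not (lookup X w))
  ∣V∣∸σ≡outside X i = trans (cong (_∸ σ X i) (∣V∣≡σ+outside X i)) (m+n∸m≡n (σ X i) _)

  lookup-shape : ∀ X i → lookup (shape X) i ≡ entry (σ X i) (∣V∣ i)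
  lookup-shape X i = lookup∘tabulate (λ l → entry (σ X l) (∣V∣ l)) i

  lookup≡⇒entry≡ : ∀ {X Y} i → lookup (shape X) i ≡ lookup (shape Y) i → entry (σ X i) (∣V∣ i) ≡ entry (σ Y i) (∣V∣ i)
  lookup≡⇒entry≡ {X} {Y} i e = trans (sym (lookup-shape X i)) (trans e (lookup-shape Y i))

  σ≡⇒lookup≡ : ∀ {X Y} i → σ X i ≡ σ Y i → lookup (shape X) i ≡ lookup (shape Y) i
  σ≡⇒lookup≡ {X} {Y} i e = trans (lookup-shape X i) (trans (cong (λ s → entry s (∣V∣ i)) e) (sym (lookup-shape Y i)))

  shape-ext : ∀ {X Y} → (∀ i → lookup (shape X) i ≡ lookup (shape Y) i) → shape X ≡ shape Y
  shape-ext = Vec-≗⇒≡ _ _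

  shape≡⇒entry≡ : ∀ {X Y} → shape X ≡ shape Y → ∀ i → entry (σ X i) (∣V∣ i) ≡ entry (σ Y i) (∣V∣ i)
  shape≡⇒entry≡ same i = lookup≡⇒entry≡ i (cong (λ s → lookup s i) same)

  shape≡⇒⊨ : ∀ {X Y} → shape X ≡ shape Y → G ⊨ φ [ X ] → G ⊨ φ [ Y ]
  shape≡⇒⊨ {X} {Y} same = Similar-Sat G P φ (record
    { type≡ = λ () ; ≡⇒≡ = λ () ; ≡⇐≡ = λ () ; membership≡ = λ () ; cells≈ = cells })
    where
    count-cell : ∀ Z i b → count (cell G P [] (Z ∷ []) i (b ∷ [])) ≡ count (λ w → isType i w ∧ (lookup Z w == b))
    count-cell Z i b = trans (count-cell-∷ˢ G P [] [] Z i b []) (count-cong λ w →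
      cong (_∧ (lookup Z w == b)) (∧-identityʳ (isType i w)))
    cells : ∀ i p → count (cell G P [] (X ∷ []) i p) ≈[ qφ ] count (cell G P [] (Y ∷ []) i p)
    cells i (true ∷ []) = subst₂ (_≈[ qφ ]_)
      (trans (σ≡count X i) (sym (trans (count-cell X i true) (count-cong λ w → cong (isType i w ∧_) (==-true (lookup X w))))))
      (trans (σ≡count Y i) (sym (trans (count-cell Y i true) (count-cong λ w → cong (isType i w ∧_) (==-true (lookup Y w))))))
      (proj₁ (entry≡⇒≈ (shape≡⇒entry≡ same i)))
    cells i (false ∷ []) = subst₂ (_≈[ qφ ]_)
      (trans (∣V∣∸σ≡outside X i) (sym (trans (count-cell X i false) (count-cong λ w → cong (isType i w ∧_) (==-false (lookup X w))))))
      (trans (∣V∣∸σ≡outside Y i) (sym (trans (count-cell Y i false) (count-cong λ w → cong (isType i w ∧_) (==-false (lookup Y w))))))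
      (proj₂ (entry≡⇒≈ (shape≡⇒entry≡ same i)))

  just≢nothing : ∀ {a : ℕ} → just a ≢ nothing
  just≢nothing ()

  -- Condition A1–A3 for entries x ↦ y of a block of size m; B1–B3 is the same with x, y swapped.
  EntryDrop : Maybe ℕ → Maybe ℕ → ℕ → Set
  EntryDrop x y m =
      (Σ ℕ λ a → Σ ℕ λ b → x ≡ just a × y ≡ just b × b + 1 ≡ a)
    ⊎ (x ≡ nothing × Σ ℕ λ b → y ≡ just b × b + 1 ≡ qφ)
    ⊎ (Σ ℕ λ a → x ≡ just a × a + qφ ≡ m + 1 × y ≡ nothing)

  CondB⇒EntryDrop : ∀ σ₁ σ₂ j → CondB G φ P σ₁ σ₂ j → EntryDrop (lookup σ₂ j) (lookup σ₁ j) (∣V∣ j)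
  CondB⇒EntryDrop σ₁ σ₂ j (inj₁ (a , b , e₁ , e₂ , a+1≡b)) = inj₁ (b , a , e₂ , e₁ , a+1≡b)
  CondB⇒EntryDrop σ₁ σ₂ j (inj₂ B₂₃) = inj₂ B₂₃

  EntryDrop⇒CondB : ∀ σ₁ σ₂ j → EntryDrop (lookup σ₂ j) (lookup σ₁ j) (∣V∣ j) → CondB G φ P σ₁ σ₂ j
  EntryDrop⇒CondB σ₁ σ₂ j (inj₁ (b , a , e₂ , e₁ , a+1≡b)) = inj₁ (a , b , e₁ , e₂ , a+1≡b)
  EntryDrop⇒CondB σ₁ σ₂ j (inj₂ A₂₃) = inj₂ A₂₃

  -- Conditions (1)–(3) at an index where the count drops from s to r and the entry from x to y.
  DropAt : Maybe ℕ → Maybe ℕ → ℕ → ℕ → ℕ → Set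
  DropAt x y s r m = EntryDrop x y m × (x ≡ nothing → s ≡ qφ) × (y ≡ nothing → r ≡ m ∸ qφ)

  entry-drop : ∀ s m → entry (suc s) m ≢ entry s m → DropAt (entry (suc s) m) (entry s m) (suc s) s m
  entry-drop s m changed with entry-cases (suc s) m | entry-cases s m
  ... | inj₁ (e₁ , _) | inj₁ (e₂ , _) = ⊥-elim (changed (trans e₁ (sym e₂)))
  ... | inj₂ (e₁ , _) | inj₂ (e₂ , _) =
    inj₁ (suc s , s , e₁ , e₂ , +-comm s 1) ,
    (⊥-elim ∘ just≢nothing ∘ trans (sym e₁)) , (⊥-elim ∘ just≢nothing ∘ trans (sym e₂))
  ... | inj₁ (e₁ , q≤1+s , 1+s≤m∸q) | inj₂ (e₂ , ¬mid) =
    inj₂ (inj₁ (e₁ , s , e₂ , trans (+-comm s 1) 1+s≡q)) , (λ _ → 1+s≡q) , (⊥-elim ∘ just≢nothing ∘ trans (sym e₂))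
    where
    1+s≡q : suc s ≡ qφ
    1+s≡q with qφ ≤? s
    ... | yes q≤s = ⊥-elim (¬mid (q≤s , ≤-trans (n≤1+n s) 1+s≤m∸q))
    ... | no q≰s  = ≤-antisym (≰⇒> q≰s) q≤1+s
  ... | inj₂ (e₁ , ¬mid) | inj₁ (e₂ , mid) =
    inj₂ (inj₂ (suc s , e₁ , arith , e₂)) , (⊥-elim ∘ just≢nothing ∘ trans (sym e₁)) , (λ _ → s≡m∸q)
    where
    s≡m∸q : s ≡ m ∸ qφ
    s≡m∸q with suc s ≤? m ∸ qφ
    ... | yes 1+s≤ = ⊥-elim (¬mid (≤-trans (proj₁ mid) (n≤1+n s) , 1+s≤))
    ... | no 1+s≰  = ≤-antisym (proj₂ mid) (≤-pred (≰⇒> 1+s≰))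
    arith : suc s + qφ ≡ m + 1
    arith = trans (cong (λ x → suc x + qφ) s≡m∸q) (trans (cong suc (m∸n+n≡m (Middle⇒q≤m mid))) (+-comm 1 m))

  DropAt-entry⇒suc : ∀ {s r m} → DropAt (entry s m) (entry r m) s r m → s ≡ suc r
  DropAt-entry⇒suc (inj₁ (a , b , e₁ , e₂ , b+1≡a) , _ , _) =
    trans (entry≡just⇒≡ e₁) (trans (sym b+1≡a) (trans (+-comm b 1) (cong suc (sym (entry≡just⇒≡ e₂)))))
  DropAt-entry⇒suc (inj₂ (inj₁ (e₁ , b , e₂ , b+1≡q)) , s≡q , _) =
    trans (s≡q e₁) (trans (sym b+1≡q) (trans (+-comm b 1) (cong suc (sym (entry≡just⇒≡ e₂)))))
  DropAt-entry⇒suc {m = m} (inj₂ (inj₂ (a , e₁ , a+q≡m+1 , e₂)) , _ , r≡m∸q) =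
    trans (entry≡just⇒≡ e₁) (trans a≡ (cong suc (sym (r≡m∸q e₂))))
    where
    a≡ : a ≡ suc (m ∸ qφ)
    a≡ = begin
      a                 ≡⟨ m+n∸n≡m a qφ ⟨
      a + qφ ∸ qφ       ≡⟨ cong (_∸ qφ) a+q≡m+1 ⟩
      m + 1 ∸ qφ        ≡⟨ +-∸-comm 1 (Middle⇒q≤m (entry≡nothing⇒Middle e₂)) ⟩
      m ∸ qφ + 1        ≡⟨ +-comm (m ∸ qφ) 1 ⟩
      suc (m ∸ qφ)      ∎
      where open ≡-Reasoning

  Drop : Subset n → Subset n → Fin t → Set
  Drop A B i = DropAt (lookup (shape A) i) (lookup (shape B) i) (σ A i) (σ B i) (∣V∣ i)

  σ≡suc⇒Drop : ∀ {A B} i → σ A i ≡ suc (σ B i) → lookup (shape A) i ≢ lookup (shape B) i → Drop A B i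
  σ≡suc⇒Drop {A} {B} i σA≡ changed = subst₂ (λ x y → DropAt x y (σ A i) (σ B i) (∣V∣ i))
    (sym (lookup-shape A i)) (sym (lookup-shape B i))
    (subst (λ s → DropAt (entry s (∣V∣ i)) (entry (σ B i) (∣V∣ i)) s (σ B i) (∣V∣ i)) (sym σA≡)
      (entry-drop (σ B i) (∣V∣ i) λ e → changed (trans (lookup-shape A i) (trans (cong (λ s → entry s (∣V∣ i)) σA≡)
                                                                   (trans e (sym (lookup-shape B i)))))))

  Drop⇒σ≡suc : ∀ {A B} i → Drop A B i → σ A i ≡ suc (σ B i)
  Drop⇒σ≡suc {A} {B} i D = DropAt-entry⇒suc
    (subst₂ (λ x y → DropAt x y (σ A i) (σ B i) (∣V∣ i)) (lookup-shape A i) (lookup-shape B i) D)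

-- Token jumps

record Jump (A B : Subset n) (u v : Fin n) : Set where
  field
    u∈A       : lookup A u ≡ true
    u∉B       : lookup B u ≡ false
    v∉A       : lookup A v ≡ false
    v∈B       : lookup B v ≡ true
    elsewhere : ∀ w → w ≢ u → w ≢ v → lookup A w ≡ lookup B w
open Jump public

jump : Subset n → Fin n → Fin n → Subset n
jump A u v = tabulate λ w → if ⌊ w ≟ v ⌋ then true else if ⌊ w ≟ u ⌋ then false else lookup A w

jump-Jump : (A : Subset n) (u v : Fin n) → lookup A u ≡ true → lookup A v ≡ false → Jump A (jump A u v) u v
jump-Jump A u v u∈A v∉A = record
  { u∈A = u∈A ; u∉B = at-u ; v∉A = v∉A ; v∈B = at-v ; elsewhere = at-other }
  where
  u≢v : u ≢ v
  u≢v refl with () ← trans (sym u∈A) v∉A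
  new : Fin _ → Bool
  new w = if ⌊ w ≟ v ⌋ then true else if ⌊ w ≟ u ⌋ then false else lookup A w
  at-u : lookup (jump A u v) u ≡ false
  at-u rewrite lookup∘tabulate new u | ⌊≟⌋-≢ u≢v | ⌊≟⌋-refl u = refl
  at-v : lookup (jump A u v) v ≡ true
  at-v rewrite lookup∘tabulate new v | ⌊≟⌋-refl v = refl
  at-other : ∀ w → w ≢ u → w ≢ v → lookup A w ≡ lookup (jump A u v) w
  at-other w w≢u w≢v rewrite lookup∘tabulate new w | ⌊≟⌋-≢ w≢v | ⌊≟⌋-≢ w≢u = refl

module _ {A B : Subset n} {u v : Fin n} (J : Jump A B u v) where

  Jump-∖ : (g : Fin n → Bool) → ∀ w → ((λ x → g x ∧ lookup A x) ∖ u) w ≡ ((λ x → g x ∧ lookup B x) ∖ v) w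
  Jump-∖ g w with u ≟ w | v ≟ w
  ... | yes refl | yes refl = trans (∧-zeroʳ _) (sym (∧-zeroʳ _))
  ... | yes refl | no _ rewrite u∉B J | ∧-zeroʳ (g w) = ∧-zeroʳ _
  ... | no _ | yes refl rewrite v∉A J | ∧-zeroʳ (g w) = sym (∧-zeroʳ _)
  ... | no u≢w | no v≢w = cong (λ b → (g w ∧ b) ∧ true) (elsewhere J w (u≢w ∘ sym) (v≢w ∘ sym))

  count-Jump : (g : Fin n → Bool) →
    count (λ w → g w ∧ lookup A w) + indicator (g v) ≡ count (λ w → g w ∧ lookup B w) + indicator (g u)
  count-Jump g = begin
    count gA + indicator (g v)                              ≡⟨ cong (_+ indicator (g v)) (count-∖ gA u) ⟩
    indicator (g u ∧ lookup A u) + count (gA ∖ u) + indicator (g v)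
      ≡⟨ cong (λ b → indicator (g u ∧ b) + count (gA ∖ u) + indicator (g v)) (u∈A J) ⟩
    indicator (g u ∧ true) + count (gA ∖ u) + indicator (g v)
      ≡⟨ cong (λ b → indicator b + count (gA ∖ u) + indicator (g v)) (∧-identityʳ (g u)) ⟩
    indicator (g u) + count (gA ∖ u) + indicator (g v)
      ≡⟨ cong (λ d → indicator (g u) + d + indicator (g v)) (count-cong (Jump-∖ g)) ⟩
    indicator (g u) + D + indicator (g v)                   ≡⟨ swap (indicator (g u)) D (indicator (g v)) ⟩
    indicator (g v) + D + indicator (g u)
      ≡⟨ cong (λ b → indicator b + D + indicator (g u)) (sym (∧-identityʳ (g v))) ⟩
    indicator (g v ∧ true) + D + indicator (g u)
      ≡⟨ cong (λ b → indicator (g v ∧ b) + D + indicator (g u)) (sym (v∈B J)) ⟩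
    indicator (g v ∧ lookup B v) + D + indicator (g u)      ≡⟨ cong (_+ indicator (g u)) (count-∖ gB v) ⟨
    count gB + indicator (g u)                              ∎
    where
    open ≡-Reasoning
    gA gB : Fin _ → Bool
    gA w = g w ∧ lookup A w
    gB w = g w ∧ lookup B w
    D = count (gB ∖ v)
    swap : ∀ a d b → a + d + b ≡ b + d + a
    swap a d b = trans (+-assoc a d b) (trans (+-comm a (d + b)) (cong (_+ a) (+-comm d b)))

  Jump⇒∣∣≡ : ∣ A ∣ ≡ ∣ B ∣
  Jump⇒∣∣≡ = trans (∣S∣≡count A) (trans (+-cancelʳ-≡ 1 _ _ (count-Jump (λ _ → true))) (sym (∣S∣≡count B)))

Jump-sym : {A B : Subset n} {u v : Fin n} → Jump A B u v → Jump B A v u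
Jump-sym J = record
  { u∈A = v∈B J ; u∉B = v∉A J ; v∉A = u∉B J ; v∈B = u∈A J
  ; elsewhere = λ w w≢v w≢u → sym (elsewhere J w w≢u w≢v) }

lookup-─ : (A B : Subset n) (w : Fin n) → lookup (A ─ B) w ≡ (lookup A w ∧ not (lookup B w))
lookup-─ (a ∷ A) (true ∷ B)  zero    = sym (∧-zeroʳ a)
lookup-─ (a ∷ A) (false ∷ B) zero    = sym (∧-identityʳ a)
lookup-─ (a ∷ A) (b ∷ B)     (suc w) = lookup-─ A B w

lookup-─≡true : (A B : Subset n) (w : Fin n) → lookup (A ─ B) w ≡ true → lookup A w ≡ true × lookup B w ≡ false
lookup-─≡true A B w w∈ with lookup A w | lookup B w | trans (sym (lookup-─ A B w)) w∈
... | true | false | _ = refl , refl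

Jump⇒∣─∣≡1 : {A B : Subset n} {u v : Fin n} → Jump A B u v → ∣ A ─ B ∣ ≡ 1
Jump⇒∣─∣≡1 {A = A} {B} {u} {v} J = trans (∣S∣≡count (A ─ B)) (unique⇒count≡1 _ u at-u at-other)
  where
  at-u : lookup (A ─ B) u ≡ true
  at-u rewrite lookup-─ A B u | u∈A J | u∉B J = refl
  at-other : ∀ w → w ≢ u → lookup (A ─ B) w ≡ false
  at-other w w≢u rewrite lookup-─ A B w with w ≟ v
  ... | yes refl rewrite v∉A J = refl
  ... | no w≢v rewrite elsewhere J w w≢u w≢v with lookup B w
  ...   | true  = refl
  ...   | false = refl

∣─∣≡1⇒Jump : (A B : Subset n) → ∣ A ─ B ∣ ≡ 1 → ∣ B ─ A ∣ ≡ 1 → ∃₂ λ u v → Jump A B u v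
∣─∣≡1⇒Jump A B one one' with count≡1⇒unique (lookup (A ─ B)) (trans (sym (∣S∣≡count (A ─ B))) one)
                          | count≡1⇒unique (lookup (B ─ A)) (trans (sym (∣S∣≡count (B ─ A))) one')
... | u , u∈A─B , only-u | v , v∈B─A , only-v = u , v , record
  { u∈A = proj₁ (lookup-─≡true A B u u∈A─B)
  ; u∉B = proj₂ (lookup-─≡true A B u u∈A─B)
  ; v∉A = proj₂ (lookup-─≡true B A v v∈B─A)
  ; v∈B = proj₁ (lookup-─≡true B A v v∈B─A)
  ; elsewhere = λ w w≢u w≢v → no-difference (trans (sym (lookup-─ A B w)) (only-u w w≢u))
                                            (trans (sym (lookup-─ B A w)) (only-v w w≢v)) }
  where
  no-difference : ∀ {a b} → (a ∧ not b) ≡ false → (b ∧ not a) ≡ false → a ≡ b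
  no-difference {true}  {true}  _ _ = refl
  no-difference {false} {false} _ _ = refl

count-─-Jump : {A A' : Subset n} {u v : Fin n} (C : Subset n) → Jump A A' u v →
  lookup C u ≡ false → lookup C v ≡ true →
  count (lookup (A ─ C)) ≡ suc (count (lookup (A' ─ C)))
count-─-Jump {A = A} {A'} {u} {v} C J u∉C v∈C = count-differ-at _ _ u at-u at-u' at-other
  where
  at-u : lookup (A ─ C) u ≡ true
  at-u rewrite lookup-─ A C u | u∈A J | u∉C = refl
  at-u' : lookup (A' ─ C) u ≡ false
  at-u' rewrite lookup-─ A' C u | u∉B J = refl
  at-other : ∀ w → w ≢ u → lookup (A ─ C) w ≡ lookup (A' ─ C) w
  at-other w w≢u rewrite lookup-─ A C w | lookup-─ A' C w with w ≟ v
  ... | yes refl rewrite v∈C = trans (∧-zeroʳ _) (sym (∧-zeroʳ _))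
  ... | no w≢v rewrite elsewhere J w w≢u w≢v = refl

─≡∅⇒≡ : (A B : Subset n) → count (lookup (A ─ B)) ≡ 0 → ∣ A ∣ ≡ ∣ B ∣ → A ≡ B
─≡∅⇒≡ A B empty ∣A∣≡∣B∣ = Vec-≗⇒≡ A B pointwise
  where
  A⊆B : ∀ w → lookup A w ≡ true → lookup B w ≡ true
  A⊆B w w∈A with lookup B w in w∈B
  ... | true  = refl
  ... | false with () ← trans (sym (count≡0⇒false _ empty w)) (trans (lookup-─ A B w) (cong₂ (λ a b → a ∧ not b) w∈A w∈B))
  pointwise : ∀ w → lookup A w ≡ lookup B w
  pointwise w with lookup A w in w∈A | lookup B w in w∈B
  ... | true  | _     = sym (trans (sym w∈B) (A⊆B w w∈A))
  ... | false | false = refl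
  ... | false | true  = ⊥-elim (<⇒≢ ∣A∣<∣B∣ ∣A∣≡∣B∣)
    where
    ∣A∣<∣B∣ : ∣ A ∣ < ∣ B ∣
    ∣A∣<∣B∣ = subst₂ _<_ (sym (∣S∣≡count A)) (sym (∣S∣≡count B)) (begin-strict
      count (lookup A)                                        ≤⟨ count-mono (λ x x∈A → cong₂ _∧_ (A⊆B x x∈A) x∈A) ⟩
      count (λ x → lookup B x ∧ lookup A x)                   <⟨ m<m+n _ (true⇒count>0 _ w (cong₂ (λ b a → b ∧ not a) w∈B w∈A)) ⟩
      count (λ x → lookup B x ∧ lookup A x) + count (λ x → lookup B x ∧ not (lookup A x)) ≡⟨ count-split (lookup B) (lookup A) ⟨
      count (lookup B)                                        ∎)
      where open ≤-Reasoning

module JumpShapes {n c : ℕ} (G : ColoredGraph n c) (φ : Formula c 0 1) (P : TypePartition G) where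
  open TypePartition P
  open Shapes G φ P

  module _ {A B : Subset n} {u v : Fin n} (J : Jump A B u v) where

    σ-Jump : ∀ l → σ A l + indicator (isType l v) ≡ σ B l + indicator (isType l u)
    σ-Jump l = subst₂ (λ a b → a + indicator (isType l v) ≡ b + indicator (isType l u))
      (sym (σ≡count A l)) (sym (σ≡count B l)) (count-Jump J (isType l))

    σ-Jump-≢ : ∀ l → ty u ≢ l → ty v ≢ l → σ A l ≡ σ B l
    σ-Jump-≢ l u≢l v≢l = +-cancelʳ-≡ 0 _ _
      (subst₂ (λ a b → σ A l + indicator a ≡ σ B l + indicator b) (⌊≟⌋-≢ v≢l) (⌊≟⌋-≢ u≢l) (σ-Jump l))

    σ-Jump-same : ty u ≡ ty v → ∀ l → σ A l ≡ σ B l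
    σ-Jump-same tu≡tv l = +-cancelʳ-≡ (indicator (isType l u)) _ _
      (subst (λ x → σ A l + indicator ⌊ x ≟ l ⌋ ≡ σ B l + indicator (isType l u)) (sym tu≡tv) (σ-Jump l))

    σ-Jump-from : ty u ≢ ty v → σ A (ty u) ≡ suc (σ B (ty u))
    σ-Jump-from tu≢tv = begin
      σ A (ty u)                                  ≡⟨ +-identityʳ _ ⟨
      σ A (ty u) + indicator false                ≡⟨ cong (λ b → σ A (ty u) + indicator b) (⌊≟⌋-≢ (tu≢tv ∘ sym)) ⟨
      σ A (ty u) + indicator (isType (ty u) v)    ≡⟨ σ-Jump (ty u) ⟩
      σ B (ty u) + indicator (isType (ty u) u)    ≡⟨ cong (λ b → σ B (ty u) + indicator b) (⌊≟⌋-refl (ty u)) ⟩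
      σ B (ty u) + 1                              ≡⟨ +-comm _ 1 ⟩
      suc (σ B (ty u))                            ∎
      where open ≡-Reasoning

  module _ (k : ℕ) {A B : Subset n} {u v : Fin n} (⊨A : G ⊨ φ [ A ]) (⊨B : G ⊨ φ [ B ])
           (∣A∣ : ∣ A ∣ ≡ k) (∣B∣ : ∣ B ∣ ≡ k) (J : Jump A B u v) (i≢j : ty u ≢ ty v) where
    private
      i j : Fin t
      i = ty u
      j = ty v

      agree-outside : ∀ {mi mj} → (mi ≢ just i → lookup (shape A) i ≡ lookup (shape B) i) →
        (mj ≢ just j → lookup (shape A) j ≡ lookup (shape B) j) → AgreeOutside G φ P (shape A) (shape B) mi mj
      agree-outside at-i at-j l mi≢l mj≢l with l ≟ i | l ≟ j
      ... | yes refl | _        = at-i mi≢l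
      ... | no _     | yes refl = at-j mj≢l
      ... | no l≢i   | no l≢j   = σ≡⇒lookup≡ l (σ-Jump-≢ J l (l≢i ∘ sym) (l≢j ∘ sym))

      drop : lookup (shape A) i ≢ lookup (shape B) i → Drop A B i
      drop = σ≡suc⇒Drop i (σ-Jump-from J i≢j)

      rise : lookup (shape B) j ≢ lookup (shape A) j → Drop B A j
      rise = σ≡suc⇒Drop j (σ-Jump-from (Jump-sym J) (i≢j ∘ sym))

      cond-i₂ : Drop A B i → ∀ i' → just i ≡ just i' → lookup (shape A) i' ≡ nothing → σ A i' ≡ qφ
      cond-i₂ D _ refl = proj₁ (proj₂ D)

      cond-i₃ : Drop A B i → ∀ i' → just i ≡ just i' → lookup (shape B) i' ≡ nothing → σ B i' ≡ ∣V∣ i' ∸ qφ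
      cond-i₃ D _ refl = proj₂ (proj₂ D)

      cond-j₂ : Drop B A j → ∀ j' → just j ≡ just j' → lookup (shape A) j' ≡ nothing → σ A j' ≡ ∣V∣ j' ∸ qφ
      cond-j₂ D _ refl = proj₂ (proj₂ D)

      cond-j₃ : Drop B A j → ∀ j' → just j ≡ just j' → lookup (shape B) j' ≡ nothing → σ B j' ≡ qφ
      cond-j₃ D _ refl = proj₁ (proj₂ D)

      feasible : Feasible G φ P k (shape A)
      feasible = A , ⊨A , ∣A∣ , refl

      feasible' : Feasible G φ P k (shape B)
      feasible' = B , ⊨B , ∣B∣ , refl

    Jump-distinct-types : shape A ≡ shape B ⊎ ShapeEdge G φ P k (shape A) (shape B)
    Jump-distinct-types with Maybe-≡-dec _≟ℕ_ (lookup (shape A) i) (lookup (shape B) i)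
                           | Maybe-≡-dec _≟ℕ_ (lookup (shape A) j) (lookup (shape B) j)
    ... | yes same-i | yes same-j =
      inj₁ (shape-ext λ l → agree-outside {nothing} {nothing} (λ _ → same-i) (λ _ → same-j) l (λ ()) (λ ()))
    ... | no ≢i | yes same-j = inj₂ (feasible , feasible' , inj₂ (inj₁ (i ,
      agree-outside (λ i≢i → ⊥-elim (i≢i refl)) (λ _ → same-j) , proj₁ (drop ≢i) ,
      (A , ∣A∣ , refl , cond-i₂ (drop ≢i) , λ _ ()) , (B , ∣B∣ , refl , cond-i₃ (drop ≢i) , λ _ ()))))
    ... | yes same-i | no ≢j = inj₂ (feasible , feasible' , inj₂ (inj₂ (j ,
      agree-outside (λ _ → same-i) (λ j≢j → ⊥-elim (j≢j refl)) , EntryDrop⇒CondB (shape A) (shape B) j (proj₁ (rise (≢j ∘ sym))) ,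
      (A , ∣A∣ , refl , (λ _ ()) , cond-j₂ (rise (≢j ∘ sym))) , (B , ∣B∣ , refl , (λ _ ()) , cond-j₃ (rise (≢j ∘ sym))))))
    ... | no ≢i | no ≢j = inj₂ (feasible , feasible' , inj₁ (i , j , i≢j ,
      agree-outside (λ i≢i → ⊥-elim (i≢i refl)) (λ j≢j → ⊥-elim (j≢j refl)) ,
      proj₁ (drop ≢i) , EntryDrop⇒CondB (shape A) (shape B) j (proj₁ (rise (≢j ∘ sym))) ,
      (A , ∣A∣ , refl , cond-i₂ (drop ≢i) , cond-j₂ (rise (≢j ∘ sym))) ,
      (B , ∣B∣ , refl , cond-i₃ (drop ≢i) , cond-j₃ (rise (≢j ∘ sym)))))

  Jump⇒shape≡⊎ShapeEdge : ∀ k {A B u v} → G ⊨ φ [ A ] → G ⊨ φ [ B ] → ∣ A ∣ ≡ k → ∣ B ∣ ≡ k → Jump A B u v →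
    shape A ≡ shape B ⊎ ShapeEdge G φ P k (shape A) (shape B)
  Jump⇒shape≡⊎ShapeEdge k {u = u} {v} ⊨A ⊨B ∣A∣ ∣B∣ J with ty u ≟ ty v
  ... | yes tu≡tv = inj₁ (shape-ext λ l → σ≡⇒lookup≡ l (σ-Jump-same J tu≡tv l))
  ... | no  tu≢tv = Jump-distinct-types k ⊨A ⊨B ∣A∣ ∣B∣ J tu≢tv

  TJ⇒SameComponent : ∀ k {A B} → Star (TJStep G φ) A B → ∣ A ∣ ≡ k → SameComponent G φ P k (shape A) (shape B)
  TJ⇒SameComponent k ε _ = ε
  TJ⇒SameComponent k {A} {B} (_◅_ {j = C} (⊨A , ⊨C , ∣A─C∣ , ∣C─A∣) rest) ∣A∣
    with ∣─∣≡1⇒Jump A C ∣A─C∣ ∣C─A∣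
  ... | u , v , J with Jump⇒shape≡⊎ShapeEdge k ⊨A ⊨C ∣A∣ ∣C∣ J | TJ⇒SameComponent k rest ∣C∣
    where ∣C∣ = trans (sym (Jump⇒∣∣≡ J)) ∣A∣
  ...   | inj₁ same | path = subst (λ s → SameComponent G φ P k s (shape B)) (sym same) path
  ...   | inj₂ shape-edge | path = fwd shape-edge ◅ path

module ShapePaths {n c : ℕ} (G : ColoredGraph n c) (φ : Formula c 0 1) (P : TypePartition G) where
  open TypePartition P
  open Shapes G φ P
  open JumpShapes G φ P

  σ<σ⇒∃ : ∀ {A B} l → σ A l < σ B l → ∃ λ v → lookup B v ≡ true × lookup A v ≡ false × ty v ≡ l
  σ<σ⇒∃ {A} {B} l σA<σB with count>0⇒∃ (λ w → (isType l w ∧ lookup B w) ∧ not (lookup A w)) positive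
    where
    both = count (λ w → (isType l w ∧ lookup B w) ∧ lookup A w)
    both≤σA : both ≤ σ A l
    both≤σA = subst (both ≤_) (sym (σ≡count A l))
      (count-mono {f = λ w → (isType l w ∧ lookup B w) ∧ lookup A w} {g = λ w → isType l w ∧ lookup A w}
                  λ w → drop-middle (isType l w) (lookup B w) (lookup A w))
      where
      drop-middle : ∀ a b c → ((a ∧ b) ∧ c) ≡ true → (a ∧ c) ≡ true
      drop-middle true true true _ = refl
    positive : 0 < count (λ w → (isType l w ∧ lookup B w) ∧ not (lookup A w))
    positive with count (λ w → (isType l w ∧ lookup B w) ∧ not (lookup A w)) in only-B
    ... | suc _ = s≤s z≤n
    ... | zero  = ⊥-elim (<⇒≱ σA<σB (begin
      σ B l                ≡⟨ σ≡count B l ⟩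
      count (λ w → isType l w ∧ lookup B w) ≡⟨ count-split (λ w → isType l w ∧ lookup B w) (lookup A) ⟩
      both + count (λ w → (isType l w ∧ lookup B w) ∧ not (lookup A w)) ≡⟨ cong (both +_) only-B ⟩
      both + 0             ≡⟨ +-identityʳ both ⟩
      both                 ≤⟨ both≤σA ⟩
      σ A l                ∎))
      where open ≤-Reasoning
  ... | v , v∈ with isType l v in tv | lookup B v in v∈B | lookup A v in v∉A
  ...   | true | true | false = v , v∈B , v∉A , isType⇒≡ tv

  sum-σ : ∀ X → sum (σ X) ≡ ∣ X ∣
  sum-σ X = trans (sum-cong-≗ (σ≡count X)) (trans (sym (count-partition ty (lookup X))) (sym (∣S∣≡count X)))

  ∃σ< : ∀ {A B} i → ∣ A ∣ ≡ ∣ B ∣ → σ B i < σ A i → ∃ λ l → l ≢ i × σ A l < σ B l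
  ∃σ< {A} {B} i ∣A∣≡∣B∣ σB<σA with sum-<⇒∃< (σ A) (λ l → σ B l + δ l) sum<
    where
    δ : Fin t → ℕ
    δ l = indicator (⌊ i ≟ l ⌋ ∧ true)
    sum< : sum (σ A) < sum (λ l → σ B l + δ l)
    sum< = begin-strict
      sum (σ A)                   ≡⟨ trans (sum-σ A) ∣A∣≡∣B∣ ⟩
      ∣ B ∣                       <⟨ n<1+n ∣ B ∣ ⟩
      suc ∣ B ∣                   ≡⟨ +-comm 1 ∣ B ∣ ⟩
      ∣ B ∣ + 1                   ≡⟨ cong₂ _+_ (sum-σ B) (sum-indicator-≟ i true) ⟨
      sum (σ B) + sum δ           ≡⟨ ∑-distrib-+ (σ B) δ ⟨
      sum (λ l → σ B l + δ l)     ∎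
      where open ≤-Reasoning
  ... | l , σAl< with i ≟ l
  ...   | yes refl = ⊥-elim (<⇒≱ σB<σA (≤-pred (subst (σ A i <_) (+-comm (σ B i) 1) σAl<)))
  ...   | no i≢l   = l , i≢l ∘ sym , subst (σ A l <_) (+-identityʳ (σ B l)) σAl<

  shape-Jump : ∀ {S₁ S S₂ u v} → Jump S₁ S u v → ty u ≢ ty v →
    (∀ l → l ≢ ty u → l ≢ ty v → lookup (shape S₁) l ≡ lookup (shape S₂) l) →
    (∀ s → σ S₁ (ty u) ≡ suc s → entry s (∣V∣ (ty u)) ≡ entry (σ S₂ (ty u)) (∣V∣ (ty u))) →
    entry (suc (σ S₁ (ty v))) (∣V∣ (ty v)) ≡ entry (σ S₂ (ty v)) (∣V∣ (ty v)) →
    shape S ≡ shape S₂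
  shape-Jump {S₁} {S} {S₂} {u} {v} J i≢j agree at-i at-j = shape-ext pointwise
    where
    pointwise : ∀ l → lookup (shape S) l ≡ lookup (shape S₂) l
    pointwise l with l ≟ ty u | l ≟ ty v
    ... | yes refl | _ =
      trans (lookup-shape S l) (trans (at-i (σ S l) (σ-Jump-from J i≢j)) (sym (lookup-shape S₂ l)))
    ... | no _ | yes refl = trans (lookup-shape S l)
      (trans (cong (λ s → entry s (∣V∣ l)) (σ-Jump-from (Jump-sym J) (i≢j ∘ sym))) (trans at-j (sym (lookup-shape S₂ l))))
    ... | no l≢i | no l≢j = trans (sym (σ≡⇒lookup≡ l (σ-Jump-≢ J l (l≢i ∘ sym) (l≢j ∘ sym)))) (agree l l≢i l≢j)

  record JumpToward (S₁ S₂ : Subset n) : Set where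
    field
      {target}      : Subset n
      {from to}     : Fin n
      jumps         : Jump S₁ target from to
      from∉S₂       : lookup S₂ from ≡ false
      to∈S₂         : lookup S₂ to ≡ true
      reaches-shape : shape target ≡ shape S₂

  jump-between : ∀ {S₁ S₂} i j → i ≢ j → σ S₂ i < σ S₁ i → σ S₁ j < σ S₂ j →
    (∀ l → l ≢ i → l ≢ j → lookup (shape S₁) l ≡ lookup (shape S₂) l) →
    (∀ s → σ S₁ i ≡ suc s → entry s (∣V∣ i) ≡ entry (σ S₂ i) (∣V∣ i)) →
    entry (suc (σ S₁ j)) (∣V∣ j) ≡ entry (σ S₂ j) (∣V∣ j) → JumpToward S₁ S₂
  jump-between {S₁} i j i≢j σ₂<σ₁ σ₁<σ₂ agree at-i at-j with σ<σ⇒∃ i σ₂<σ₁ | σ<σ⇒∃ j σ₁<σ₂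
  ... | u , u∈S₁ , u∉S₂ , refl | v , v∈S₂ , v∉S₁ , refl = record
    { jumps = jump-Jump S₁ u v u∈S₁ v∉S₁ ; from∉S₂ = u∉S₂ ; to∈S₂ = v∈S₂
    ; reaches-shape = shape-Jump (jump-Jump S₁ u v u∈S₁ v∉S₁) i≢j agree at-i at-j }

  jump-toward-drop : ∀ {S₁ S₂} i → ∣ S₁ ∣ ≡ ∣ S₂ ∣ → σ S₂ i < σ S₁ i →
    (∀ l → l ≢ i → lookup (shape S₁) l ≡ lookup (shape S₂) l) →
    (∀ s → σ S₁ i ≡ suc s → entry s (∣V∣ i) ≡ entry (σ S₂ i) (∣V∣ i)) → JumpToward S₁ S₂
  jump-toward-drop i ∣∣≡ σ₂<σ₁ agree at-i with ∃σ< i ∣∣≡ σ₂<σ₁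
  ... | l , l≢i , σ₁<σ₂ = jump-between i l (l≢i ∘ sym) σ₂<σ₁ σ₁<σ₂ (λ l' l'≢i _ → agree l' l'≢i) at-i
    (trans (entry-between at-l (n≤1+n _) σ₁<σ₂) at-l)
    where at-l = lookup≡⇒entry≡ l (agree l l≢i)

  jump-toward-rise : ∀ {S₁ S₂} j → ∣ S₁ ∣ ≡ ∣ S₂ ∣ → σ S₁ j < σ S₂ j →
    (∀ l → l ≢ j → lookup (shape S₁) l ≡ lookup (shape S₂) l) →
    entry (suc (σ S₁ j)) (∣V∣ j) ≡ entry (σ S₂ j) (∣V∣ j) → JumpToward S₁ S₂
  jump-toward-rise {S₁} {S₂} j ∣∣≡ σ₁<σ₂ agree at-j with ∃σ< {S₂} {S₁} j (sym ∣∣≡) σ₁<σ₂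
  ... | l , l≢j , σ₂<σ₁ = jump-between l j l≢j σ₂<σ₁ σ₁<σ₂ (λ l' _ l'≢j → agree l' l'≢j) at-l at-j
    where
    at-l : ∀ s → σ S₁ l ≡ suc s → entry s (∣V∣ l) ≡ entry (σ S₂ l) (∣V∣ l)
    at-l s e = entry-between (sym (lookup≡⇒entry≡ l (agree l l≢j)))
      (≤-pred (subst (σ S₂ l <_) e σ₂<σ₁)) (subst (s ≤_) (sym e) (n≤1+n s))

  no-entrant⇒σ< : ∀ {A B u} → lookup A u ≡ true → lookup B u ≡ false →
    count (λ w → (isType (ty u) w ∧ lookup B w) ∧ not (lookup A w)) ≡ 0 → σ B (ty u) < σ A (ty u)
  no-entrant⇒σ< {A} {B} {u} u∈A u∉B none = begin-strict
    σ B i                                                   ≡⟨ σ≡count B i ⟩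
    count (λ w → isType i w ∧ lookup B w)                   ≡⟨ count-split (λ w → isType i w ∧ lookup B w) (lookup A) ⟩
    shared + count (λ w → (isType i w ∧ lookup B w) ∧ not (lookup A w)) ≡⟨ cong (shared +_) none ⟩
    shared + 0                                              ≡⟨ +-identityʳ shared ⟩
    shared                                                  ≤⟨ count-mono {f = λ w → (isType i w ∧ lookup B w) ∧ lookup A w}
                                                                          {g = inA ∖ u} shared⊆ ⟩
    count (inA ∖ u)                                         <⟨ n<1+n _ ⟩
    suc (count (inA ∖ u))                                   ≡⟨ cong (λ b → indicator b + count (inA ∖ u)) u∈inA ⟨
    indicator (inA u) + count (inA ∖ u)                     ≡⟨ count-∖ inA u ⟨
    count inA                                               ≡⟨ σ≡count A i ⟨
    σ A i                                                   ∎
    where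
    open ≤-Reasoning
    i = ty u
    inA : Fin n → Bool
    inA w = isType i w ∧ lookup A w
    shared = count (λ w → (isType i w ∧ lookup B w) ∧ lookup A w)
    u∈inA : inA u ≡ true
    u∈inA rewrite ⌊≟⌋-refl i | u∈A = refl
    shared⊆ : ∀ w → ((isType i w ∧ lookup B w) ∧ lookup A w) ≡ true → (inA ∖ u) w ≡ true
    shared⊆ w w∈ with isType i w | lookup B w in w∈B | lookup A w | u ≟ w
    ... | true | true | true | no _ = refl
    ... | true | true | true | yes refl with () ← trans (sym u∉B) w∈B

  same-shape⇒JumpToward : ∀ {A B} → 0 < count (lookup (A ─ B)) → ∣ A ∣ ≡ ∣ B ∣ → shape A ≡ shape B → JumpToward A B
  same-shape⇒JumpToward {A} {B} A⊈B ∣∣≡ same with count>0⇒∃ _ A⊈B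
  ... | u , u∈A─B with lookup-─≡true A B u u∈A─B
  ...   | u∈A , u∉B with count (λ w → (isType (ty u) w ∧ lookup B w) ∧ not (lookup A w)) in entrants
  ...     | zero = jump-toward-drop (ty u) ∣∣≡ σB<σA (λ l _ → cong (λ s → lookup s l) same)
      λ s e → entry-between (sym (shape≡⇒entry≡ same (ty u))) (≤-pred (subst (σ B (ty u) <_) e σB<σA))
                            (subst (s ≤_) (sym e) (n≤1+n s))
    where σB<σA = no-entrant⇒σ< u∈A u∉B entrants
  ...     | suc _ with count>0⇒∃ (λ w → (isType (ty u) w ∧ lookup B w) ∧ not (lookup A w))
                         (subst (0 <_) (sym entrants) (s≤s z≤n))
  ...       | v , v∈ with isType (ty u) v in tv | lookup B v in v∈B | lookup A v in v∉A
  ...         | true | true | false = record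
    { jumps = J ; from∉S₂ = u∉B ; to∈S₂ = v∈B
    ; reaches-shape = trans (sym (shape-ext λ l → σ≡⇒lookup≡ l (σ-Jump-same J (sym (isType⇒≡ tv)) l))) same }
    where J = jump-Jump A u v u∈A v∉A

  same-shape⇒TJ : ∀ d {A B} → count (lookup (A ─ B)) ≡ d → ∣ A ∣ ≡ ∣ B ∣ → shape A ≡ shape B →
    G ⊨ φ [ A ] → Star (TJStep G φ) A B
  same-shape⇒TJ zero {A} {B} A─B≡∅ ∣∣≡ _ _ = subst (Star (TJStep G φ) A) (─≡∅⇒≡ A B A─B≡∅ ∣∣≡) ε
  same-shape⇒TJ (suc d) {A} {B} ∣A─B∣ ∣∣≡ same ⊨A =
    (⊨A , ⊨A' , Jump⇒∣─∣≡1 jumps , Jump⇒∣─∣≡1 (Jump-sym jumps)) ◅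
      same-shape⇒TJ d (suc-injective (trans (sym (count-─-Jump B jumps from∉S₂ to∈S₂)) ∣A─B∣))
                    (trans (sym (Jump⇒∣∣≡ jumps)) ∣∣≡) reaches-shape ⊨A'
    where
    open JumpToward (same-shape⇒JumpToward (subst (0 <_) (sym ∣A─B∣) (s≤s z≤n)) ∣∣≡ same)
    ⊨A' = shape≡⇒⊨ (trans same (sym reaches-shape)) ⊨A

  -- How the counts of S₁ and S₂ differ across an edge of the shape graph.
  data Plan (S₁ S₂ : Subset n) : Set where
    drop-rise : ∀ i j → i ≢ j → (∀ l → l ≢ i → l ≢ j → lookup (shape S₁) l ≡ lookup (shape S₂) l) →
      σ S₁ i ≡ suc (σ S₂ i) → σ S₂ j ≡ suc (σ S₁ j) → Plan S₁ S₂
    drop : ∀ i → (∀ l → l ≢ i → lookup (shape S₁) l ≡ lookup (shape S₂) l) →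
      σ S₁ i ≡ suc (σ S₂ i) → Plan S₁ S₂
    rise : ∀ j → (∀ l → l ≢ j → lookup (shape S₁) l ≡ lookup (shape S₂) l) →
      σ S₂ j ≡ suc (σ S₁ j) → Plan S₁ S₂

  Plan-sym : ∀ {S₁ S₂} → Plan S₁ S₂ → Plan S₂ S₁
  Plan-sym (drop-rise i j i≢j agree at-i at-j) = drop-rise j i (i≢j ∘ sym) (λ l l≢j l≢i → sym (agree l l≢i l≢j)) at-j at-i
  Plan-sym (drop i agree at-i) = rise i (λ l l≢i → sym (agree l l≢i)) at-i
  Plan-sym (rise j agree at-j) = drop j (λ l l≢j → sym (agree l l≢j)) at-j

  Plan⇒JumpToward : ∀ {S₁ S₂} → Plan S₁ S₂ → ∣ S₁ ∣ ≡ ∣ S₂ ∣ → JumpToward S₁ S₂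
  Plan⇒JumpToward {S₁} {S₂} (drop-rise i j i≢j agree at-i at-j) _ =
    jump-between i j i≢j (subst (σ S₂ i <_) (sym at-i) ≤-refl) (subst (σ S₁ j <_) (sym at-j) ≤-refl) agree
      (λ s e → cong (λ x → entry x (∣V∣ i)) (suc-injective (trans (sym e) at-i)))
      (cong (λ x → entry x (∣V∣ j)) (sym at-j))
  Plan⇒JumpToward {S₁} {S₂} (drop i agree at-i) ∣∣≡ =
    jump-toward-drop i ∣∣≡ (subst (σ S₂ i <_) (sym at-i) ≤-refl) agree
      (λ s e → cong (λ x → entry x (∣V∣ i)) (suc-injective (trans (sym e) at-i)))
  Plan⇒JumpToward {S₁} {S₂} (rise j agree at-j) ∣∣≡ =
    jump-toward-rise j ∣∣≡ (subst (σ S₁ j <_) (sym at-j) ≤-refl) agree (cong (λ x → entry x (∣V∣ j)) (sym at-j))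

  Realised : ℕ → Shape G φ P → Shape G φ P → Set
  Realised k σ₁ σ₂ = ∃₂ λ S₁ S₂ → ∣ S₁ ∣ ≡ k × ∣ S₂ ∣ ≡ k × shape S₁ ≡ σ₁ × shape S₂ ≡ σ₂ × Plan S₁ S₂

  Adjacent⇒Plan : ∀ {k σ₁ σ₂} → Adjacent G φ P k σ₁ σ₂ → Realised k σ₁ σ₂
  Adjacent⇒Plan (inj₁ (i , j , i≢j , agree , cA , cB , (S₁ , ∣S₁∣ , refl , c2i , c2j) , (S₂ , ∣S₂∣ , refl , c3i , c3j))) =
    S₁ , S₂ , ∣S₁∣ , ∣S₂∣ , refl , refl , drop-rise i j i≢j
      (λ l l≢i l≢j → agree l (l≢i ∘ sym ∘ just-injective) (l≢j ∘ sym ∘ just-injective))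
      (Drop⇒σ≡suc i (cA , c2i i refl , c3i i refl))
      (Drop⇒σ≡suc j (CondB⇒EntryDrop (shape S₁) (shape S₂) j cB , c3j j refl , c2j j refl))
  Adjacent⇒Plan (inj₂ (inj₁ (i , agree , cA , (S₁ , ∣S₁∣ , refl , c2i , _) , (S₂ , ∣S₂∣ , refl , c3i , _)))) =
    S₁ , S₂ , ∣S₁∣ , ∣S₂∣ , refl , refl , drop i
      (λ l l≢i → agree l (l≢i ∘ sym ∘ just-injective) (λ ()))
      (Drop⇒σ≡suc i (cA , c2i i refl , c3i i refl))
  Adjacent⇒Plan (inj₂ (inj₂ (j , agree , cB , (S₁ , ∣S₁∣ , refl , _ , c2j) , (S₂ , ∣S₂∣ , refl , _ , c3j)))) =
    S₁ , S₂ , ∣S₁∣ , ∣S₂∣ , refl , refl , rise j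
      (λ l l≢j → agree l (λ ()) (l≢j ∘ sym ∘ just-injective))
      (Drop⇒σ≡suc j (CondB⇒EntryDrop (shape S₁) (shape S₂) j cB , c3j j refl , c2j j refl))

  edge⇒Plan : ∀ {k σ₀ σ₁} → SymClosure (ShapeEdge G φ P k) σ₀ σ₁ → Feasible G φ P k σ₁ × Realised k σ₀ σ₁
  edge⇒Plan (fwd (_ , F₁ , adj)) = F₁ , Adjacent⇒Plan adj
  edge⇒Plan (bwd (F₁ , _ , adj)) with Adjacent⇒Plan adj
  ... | S₂ , S₁ , ∣S₂∣ , ∣S₁∣ , e₂ , e₁ , plan = F₁ , S₁ , S₂ , ∣S₁∣ , ∣S₂∣ , e₁ , e₂ , Plan-sym plan

  SameComponent⇒TJ : ∀ k {σ₀ σ} → SameComponent G φ P k σ₀ σ → ∀ {A B} → G ⊨ φ [ A ] →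
    ∣ A ∣ ≡ k → shape A ≡ σ₀ → ∣ B ∣ ≡ k → shape B ≡ σ → Star (TJStep G φ) A B
  SameComponent⇒TJ k ε ⊨A ∣A∣ eA ∣B∣ eB = same-shape⇒TJ _ refl (trans ∣A∣ (sym ∣B∣)) (trans eA (sym eB)) ⊨A
  SameComponent⇒TJ k (step ◅ rest) {A} {B} ⊨A ∣A∣ eA ∣B∣ eB with edge⇒Plan step
  ... | (T , ⊨T , _ , eT) , S₁ , S₂ , ∣S₁∣ , ∣S₂∣ , e₁ , e₂ , plan =
    same-shape⇒TJ _ refl (trans ∣A∣ (sym ∣S₁∣)) (trans eA (sym e₁)) ⊨A ◅◅
      ((⊨S₁ , ⊨S , Jump⇒∣─∣≡1 jumps , Jump⇒∣─∣≡1 (Jump-sym jumps)) ◅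
        SameComponent⇒TJ k rest ⊨S (trans (sym (Jump⇒∣∣≡ jumps)) ∣S₁∣) (trans reaches-shape e₂) ∣B∣ eB)
    where
    open JumpToward (Plan⇒JumpToward plan (trans ∣S₁∣ (sym ∣S₂∣)))
    ⊨S₁ = shape≡⇒⊨ (trans eA (sym e₁)) ⊨A
    ⊨S = shape≡⇒⊨ (trans eT (sym (trans reaches-shape e₂))) ⊨T

-- The paper assumes S and S' are colours; this argument does not need it.
lemma3p7 : {n c : ℕ} (G : ColoredGraph n c) (φ : Formula c 0 1)
    (P : TypePartition G) (k : ℕ) (S S' : Subset n)
    → G ⊨ φ [ S ] → G ⊨ φ [ S' ] → ∣ S ∣ ≡ k → ∣ S' ∣ ≡ k
    → Σ (Fin c) (λ a → ColoredGraph.color G a ≡ S)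
    → Σ (Fin c) (λ b → ColoredGraph.color G b ≡ S')
    → TJSequence G φ S S' ⇔ SameComponent G φ P k (shapeOf G φ P S) (shapeOf G φ P S')
lemma3p7 G φ P k S S' ⊨S ⊨S' ∣S∣ ∣S'∣ _ _ = mk⇔
  (λ (_ , sequence) → TJ⇒SameComponent k sequence ∣S∣)
  (λ component → ⊨S , SameComponent⇒TJ k component ⊨S ∣S∣ refl ∣S'∣ refl)
  where
  open JumpShapes G φ P
  open ShapePaths G φ P
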